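{- Let $R \cong R_1 \times R_2 \times \cdots \times R_n$ with $n \ge 2$, where each $R_i$ is a local commutative ring with unity with maximal ideal $\mathcal{M}_i$. Then $\mathrm{PIS}(R)$ is unicyclic if and only if $R \cong F_1 \times R_2$, where $F_1$ is a field and $R_2$ is a local ring with $\mathcal{I}^*(R_2) = \{\mathcal{M}_2\}$.
   Context: For a commutative ring $R$ with unity, $\mathcal{I}^*(R)$ denotes the set of nonzero proper ideals of $R$. The prime ideal sum graph $\mathrm{PIS}(R)$ is the simple undirected graph with vertex set $\mathcal{I}^*(R)$, two distinct vertices $I, J$ adjacent if and only if $I+J$ is a prime ideal of $R$. A connected graph is unicyclic if it contains exactly one cycle. -}

module Defs where

open import Level using (Level; _⊔_)
open import Data.Nat using (ℕ; zero; suc)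
open import Data.Fin using (Fin; zero; suc; inject₁; fromℕ)
open import Data.Product using (Σ; ∃; ∃₂; _×_; _,_; proj₁)
open import Data.Sum using (_⊎_)
open import Relation.Nullary using (¬_)
open import Relation.Unary using (Pred; _⊆_; _≐_)
open import Relation.Binary.PropositionalEquality using (_≡_)
open import Algebra.Bundles using (CommutativeRing)
open import Algebra.Morphism.Structures using (module RingMorphisms)
import Algebra.Construct.DirectProduct as DP

private
  variable
    c ℓ : Level

_×ʳ_ : CommutativeRing c ℓ → CommutativeRing c ℓ → CommutativeRing c ℓ
R ×ʳ S = DP.commutativeRing R S

∏ʳ : {n : ℕ} → (Fin (suc n) → CommutativeRing c ℓ) → CommutativeRing c ℓ
∏ʳ {n = zero}  Rs = Rs zero
∏ʳ {n = suc n} Rs = Rs zero ×ʳ ∏ʳ (λ i → Rs (suc i))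

_≅ʳ_ : CommutativeRing c ℓ → CommutativeRing c ℓ → Set (c ⊔ ℓ)
R ≅ʳ S = ∃ λ f → RingMorphisms.IsRingIsomorphism
                    (CommutativeRing.rawRing R) (CommutativeRing.rawRing S) f

module IdealTheory (R : CommutativeRing c ℓ) where
  open CommutativeRing R using (Carrier; _≈_; _+_; _*_; -_; 0#; 1#)

  Subset : Set (Level.suc (c ⊔ ℓ))
  Subset = Pred Carrier (c ⊔ ℓ)

  record IsIdeal (I : Subset) : Set (c ⊔ ℓ) where
    field
      ∈-resp-≈  : ∀ {x y} → x ≈ y → I x → I y
      0∈        : I 0#
      +-closed  : ∀ {x y} → I x → I y → I (x + y)
      neg-closed : ∀ {x} → I x → I (- x)
      *-closed  : ∀ r {x} → I x → I (r * x)

  IsProper : Subset → Set (c ⊔ ℓ)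
  IsProper I = ¬ I 1#

  IsNonzero : Subset → Set (c ⊔ ℓ)
  IsNonzero I = ∃ λ x → I x × ¬ (x ≈ 0#)

  IsPrime : Subset → Set (c ⊔ ℓ)
  IsPrime P = IsIdeal P × IsProper P × (∀ x y → P (x * y) → P x ⊎ P y)

  IsMaximal : Subset → Set (Level.suc (c ⊔ ℓ))
  IsMaximal M = IsIdeal M × IsProper M ×
    (∀ (J : Subset) → IsIdeal J → M ⊆ J → (J ≐ M) ⊎ J 1#)

  IsLocal : Set (Level.suc (c ⊔ ℓ))
  IsLocal = Σ Subset λ M → IsMaximal M × (∀ N → IsMaximal N → N ≐ M)

  IsField : Set (c ⊔ ℓ)
  IsField = ¬ (1# ≈ 0#) × (∀ x → ¬ (x ≈ 0#) → ∃ λ y → x * y ≈ 1#)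

  _+ᴵ_ : Subset → Subset → Subset
  (I +ᴵ J) x = ∃₂ λ a b → I a × J b × x ≈ a + b

  Vertex : Set (Level.suc (c ⊔ ℓ))
  Vertex = Σ Subset λ I → IsIdeal I × IsNonzero I × IsProper I

  _≈ᵛ_ : Vertex → Vertex → Set (c ⊔ ℓ)
  u ≈ᵛ v = proj₁ u ≐ proj₁ v

  Adj : Vertex → Vertex → Set (c ⊔ ℓ)
  Adj u v = ¬ (u ≈ᵛ v) × IsPrime (proj₁ u +ᴵ proj₁ v)

  record Path (u w : Vertex) : Set (Level.suc (c ⊔ ℓ)) where
    field
      len   : ℕ
      p     : Fin (suc len) → Vertex
      start : p zero ≈ᵛ u
      end   : p (fromℕ len) ≈ᵛ w
      steps : ∀ (i : Fin len) → Adj (p (inject₁ i)) (p (suc i))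

  Connected : Set (Level.suc (c ⊔ ℓ))
  Connected = ∀ u w → Path u w

  -- a cycle v₀ v₁ … v_{m+2} v₀ of length m+3 ≥ 3 with distinct vertices
  record Cycle : Set (Level.suc (c ⊔ ℓ)) where
    field
      m        : ℕ
      v        : Fin (suc (suc (suc m))) → Vertex
      distinct : ∀ i j → v i ≈ᵛ v j → i ≡ j
      steps    : ∀ (i : Fin (suc (suc m))) → Adj (v (inject₁ i)) (v (suc i))
      closing  : Adj (v (fromℕ (suc (suc m)))) (v zero)

  EdgeOf : Cycle → Vertex → Vertex → Set (c ⊔ ℓ)
  EdgeOf C x y =
      (∃ λ (i : Fin (suc (suc m))) →
          (x ≈ᵛ v (inject₁ i) × y ≈ᵛ v (suc i)) ⊎ (x ≈ᵛ v (suc i) × y ≈ᵛ v (inject₁ i)))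
    ⊎ ((x ≈ᵛ v (fromℕ (suc (suc m))) × y ≈ᵛ v zero) ⊎ (x ≈ᵛ v zero × y ≈ᵛ v (fromℕ (suc (suc m)))))
    where open Cycle C

  -- two cycles are the same cycle (subgraph) iff they have the same edges
  SameCycle : Cycle → Cycle → Set (Level.suc (c ⊔ ℓ))
  SameCycle C D = ∀ x y → (EdgeOf C x y → EdgeOf D x y) × (EdgeOf D x y → EdgeOf C x y)

  Unicyclic : Set (Level.suc (c ⊔ ℓ))
  Unicyclic = Connected × Σ Cycle λ C → ∀ D → SameCycle C D

  OnlyIdealIsMaximal : Set (Level.suc (c ⊔ ℓ))
  OnlyIdealIsMaximal = IsLocal × Σ Vertex λ M → IsMaximal (proj₁ M) × (∀ I → I ≈ᵛ M)

open IdealTheory public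

-- Every ideal of A × B is a product I × J of ideals of the factors, and P × B, A × Q are prime
-- for primes P, Q.  If a prime p is the sum of ideals x, y ⊆ p, then x, y, p form a triangle of
-- PIS.  With three local factors, with two local factors whose maximal ideals are both nonzero,
-- or with a field times a local ring having a nonzero proper ideal besides its maximal ideal,
-- there are two such triangles with different vertex sets, so PIS is not unicyclic; a product
-- of two fields has just two vertices.  Conversely, the vertices of PIS(F × S) with I*(S) = {M}
-- are the triangle 0 × M, F × 0, F × M together with the leaf 0 × S attached to 0 × M.

module Submission where

open import Defs using (_×ʳ_; ∏ʳ; _≅ʳ_; module IdealTheory)
open import Level using (Level; _⊔_; Lift; lift; lower)
open import Data.Unit using (⊤)
open import Data.Empty using (⊥; ⊥-elim)
open import Data.Nat using (ℕ; zero; suc; _<_; s≤s; z≤n)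
open import Data.Nat.Properties using (≤-pred; n≤0⇒n≡0)
open import Data.Fin using (Fin; zero; suc; inject₁; fromℕ; punchOut)
open import Data.Fin.Properties
  using (suc-injective; any?; _≟_; punchOut-injective; <⇒notInjective; injective⇒≤)
open import Data.Product using (∃; ∃₂; _×_; _,_; proj₁; proj₂; swap)
open import Data.Sum using (_⊎_; inj₁; inj₂)
open import Data.Vec.Functional using ([]; _∷_)
open import Function using (_∘_)
open import Function.Bundles using (_⇔_; mk⇔; Equivalence)
open import Function.Definitions using (Injective)
import Function.Properties.Equivalence as ⇔
open import Relation.Nullary using (¬_; yes; no)
open import Relation.Unary using (_⊆_; _≐_)
open import Relation.Unary.Properties using (≐-refl; ≐-sym; ≐-trans)
import Relation.Binary.PropositionalEquality as ≡
open ≡ using (_≡_; _≢_; subst)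
import Relation.Binary.Reasoning.Setoid as SetoidReasoning
open import Algebra.Bundles using (CommutativeRing)
open import Algebra.Core using (Op₂)
open import Algebra.Morphism.Structures using (module RingMorphisms)
import Algebra.Morphism.Construct.Composition as Composition
import Algebra.Properties.Ring as RingProperties
import Algebra.Properties.CommutativeSemigroup as CommutativeSemigroupProperties
open import Axiom.ExcludedMiddle using (ExcludedMiddle)
open import Axiom.DoubleNegationElimination using (em⇒dne)

private
  variable
    a c ℓ : Level

-- Ideals

module Ideals (T : CommutativeRing c ℓ) where
  open CommutativeRing T
  open IdealTheory T
  open RingProperties ring using (-0#≈0#; -‿+-comm; -‿distribˡ-*)
  open CommutativeSemigroupProperties +-commutativeSemigroup using (interchange)
  open SetoidReasoning setoid

  Zero : Subset
  Zero x = Lift c (x ≈ 0#)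

  Whole : Subset
  Whole _ = Lift (c ⊔ ℓ) ⊤

  Zero-isIdeal : IsIdeal Zero
  Zero-isIdeal = record
    { ∈-resp-≈   = λ x≈y (lift x≈0) → lift (trans (sym x≈y) x≈0)
    ; 0∈         = lift refl
    ; +-closed   = λ (lift x≈0) (lift y≈0) → lift (trans (+-cong x≈0 y≈0) (+-identityˡ 0#))
    ; neg-closed = λ (lift x≈0) → lift (trans (-‿cong x≈0) -0#≈0#)
    ; *-closed   = λ r (lift x≈0) → lift (trans (*-congˡ x≈0) (zeroʳ r))
    }

  Whole-isIdeal : IsIdeal Whole
  Whole-isIdeal = record
    { ∈-resp-≈   = λ _ _ → _
    ; 0∈         = _
    ; +-closed   = λ _ _ → _
    ; neg-closed = λ _ → _
    ; *-closed   = λ _ _ → _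
    }

  Zero⊆ : ∀ {I} → IsIdeal I → Zero ⊆ I
  Zero⊆ isI (lift x≈0) = IsIdeal.∈-resp-≈ isI (sym x≈0) (IsIdeal.0∈ isI)

  1∈⇒Whole⊆ : ∀ {I} → IsIdeal I → I 1# → Whole ⊆ I
  1∈⇒Whole⊆ isI 1∈I {x} _ = IsIdeal.∈-resp-≈ isI (*-identityʳ x) (IsIdeal.*-closed isI x 1∈I)

  ⊆Zero⇒≐ : ∀ {I} → IsIdeal I → I ⊆ Zero → I ≐ Zero
  ⊆Zero⇒≐ isI I⊆0 = I⊆0 , Zero⊆ isI

  1∈⇒≐Whole : ∀ {I} → IsIdeal I → I 1# → I ≐ Whole
  1∈⇒≐Whole isI 1∈I = (λ _ → _) , 1∈⇒Whole⊆ isI 1∈I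

  separate : ∀ {I J : Subset} {x} → I x → ¬ J x → ¬ (I ≐ J)
  separate x∈I x∉J (I⊆J , _) = x∉J (I⊆J x∈I)

  separate′ : ∀ {I J : Subset} {x} → ¬ I x → J x → ¬ (I ≐ J)
  separate′ x∉I x∈J (_ , J⊆I) = x∉I (J⊆I x∈J)

  proper⇒1≉0 : ∀ {I} → IsIdeal I → IsProper I → ¬ (1# ≈ 0#)
  proper⇒1≉0 isI 1∉I 1≈0 = 1∉I (Zero⊆ isI (lift 1≈0))

  +ᴵ-isIdeal : ∀ {I J} → IsIdeal I → IsIdeal J → IsIdeal (I +ᴵ J)
  +ᴵ-isIdeal isI isJ = record
    { ∈-resp-≈   = λ x≈y (a , b , a∈I , b∈J , x≈a+b) → a , b , a∈I , b∈J , trans (sym x≈y) x≈a+b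
    ; 0∈         = 0# , 0# , I.0∈ , J.0∈ , sym (+-identityˡ 0#)
    ; +-closed   = λ (a , b , a∈I , b∈J , x≈a+b) (a′ , b′ , a′∈I , b′∈J , y≈a′+b′) →
        a + a′ , b + b′ , I.+-closed a∈I a′∈I , J.+-closed b∈J b′∈J ,
        trans (+-cong x≈a+b y≈a′+b′) (interchange a b a′ b′)
    ; neg-closed = λ (a , b , a∈I , b∈J , x≈a+b) →
        - a , - b , I.neg-closed a∈I , J.neg-closed b∈J , trans (-‿cong x≈a+b) (sym (-‿+-comm a b))
    ; *-closed   = λ r (a , b , a∈I , b∈J , x≈a+b) →
        r * a , r * b , I.*-closed r a∈I , J.*-closed r b∈J , trans (*-congˡ x≈a+b) (distribˡ r a b)
    }
    where
    module I = IsIdeal isI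
    module J = IsIdeal isJ

  ⊆+ᴵˡ : ∀ {I J} → IsIdeal J → I ⊆ (I +ᴵ J)
  ⊆+ᴵˡ isJ {x} x∈I = x , 0# , x∈I , IsIdeal.0∈ isJ , sym (+-identityʳ x)

  ⊆+ᴵʳ : ∀ {I J} → IsIdeal I → J ⊆ (I +ᴵ J)
  ⊆+ᴵʳ isI {x} x∈J = 0# , x , IsIdeal.0∈ isI , x∈J , sym (+-identityˡ x)

  +ᴵ-comm : ∀ {I J} → (I +ᴵ J) ⊆ (J +ᴵ I)
  +ᴵ-comm (a , b , a∈I , b∈J , x≈a+b) = b , a , b∈J , a∈I , trans x≈a+b (+-comm a b)

  +ᴵ-resp-≐ : ∀ {I I′ J J′} → I ≐ I′ → J ≐ J′ → (I +ᴵ J) ≐ (I′ +ᴵ J′)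
  +ᴵ-resp-≐ (I⊆I′ , I′⊆I) (J⊆J′ , J′⊆J) =
    (λ (a , b , a∈ , b∈ , x≈) → a , b , I⊆I′ a∈ , J⊆J′ b∈ , x≈) ,
    (λ (a , b , a∈ , b∈ , x≈) → a , b , I′⊆I a∈ , J′⊆J b∈ , x≈)

  IsPrime-resp-≐ : ∀ {P Q} → P ≐ Q → IsPrime P → IsPrime Q
  IsPrime-resp-≐ {P} {Q} (P⊆Q , Q⊆P) (isP , 1∉P , prime) = isQ , (λ 1∈Q → 1∉P (Q⊆P 1∈Q)) , primeQ
    where
    module P = IsIdeal isP
    isQ : IsIdeal Q
    isQ = record
      { ∈-resp-≈   = λ x≈y x∈Q → P⊆Q (P.∈-resp-≈ x≈y (Q⊆P x∈Q))
      ; 0∈         = P⊆Q P.0∈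
      ; +-closed   = λ x∈Q y∈Q → P⊆Q (P.+-closed (Q⊆P x∈Q) (Q⊆P y∈Q))
      ; neg-closed = λ x∈Q → P⊆Q (P.neg-closed (Q⊆P x∈Q))
      ; *-closed   = λ r x∈Q → P⊆Q (P.*-closed r (Q⊆P x∈Q))
      }
    primeQ : ∀ x y → Q (x * y) → Q x ⊎ Q y
    primeQ x y xy∈Q with prime x y (Q⊆P xy∈Q)
    ... | inj₁ x∈P = inj₁ (P⊆Q x∈P)
    ... | inj₂ y∈P = inj₂ (P⊆Q y∈P)

  IsSumOf : Subset → Subset → Subset → Set (c ⊔ ℓ)
  IsSumOf P X Y = X ⊆ P × Y ⊆ P × P ⊆ (X +ᴵ Y)

  IsSumOf⇒+ᴵ≐ : ∀ {P X Y} → IsIdeal P → IsSumOf P X Y → (X +ᴵ Y) ≐ P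
  IsSumOf⇒+ᴵ≐ {P} {X} {Y} isP (X⊆P , Y⊆P , P⊆X+Y) = X+Y⊆P , P⊆X+Y
    where
    X+Y⊆P : (X +ᴵ Y) ⊆ P
    X+Y⊆P (a , b , a∈X , b∈Y , x≈a+b) =
      IsIdeal.∈-resp-≈ isP (sym x≈a+b) (IsIdeal.+-closed isP (X⊆P a∈X) (Y⊆P b∈Y))

  IsSumOf-⊆ˡ : ∀ {P X} → IsIdeal X → X ⊆ P → IsSumOf P X P
  IsSumOf-⊆ˡ isX X⊆P = X⊆P , (λ p → p) , ⊆+ᴵʳ isX

  IsSumOf-⊆ʳ : ∀ {P Y} → IsIdeal Y → Y ⊆ P → IsSumOf P P Y
  IsSumOf-⊆ʳ isY Y⊆P = (λ p → p) , Y⊆P , ⊆+ᴵˡ isY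

  IsSumOf-Whole : ∀ {X Y} → IsIdeal X → IsIdeal Y → (X +ᴵ Y) 1# → IsSumOf Whole X Y
  IsSumOf-Whole isX isY 1∈X+Y = _ , _ , 1∈⇒Whole⊆ (+ᴵ-isIdeal isX isY) 1∈X+Y

  Multiples : Carrier → Subset
  Multiples x z = ∃ λ r → z ≈ r * x

  Multiples-isIdeal : ∀ x → IsIdeal (Multiples x)
  Multiples-isIdeal x = record
    { ∈-resp-≈   = λ y≈z (r , y≈rx) → r , trans (sym y≈z) y≈rx
    ; 0∈         = 0# , sym (zeroˡ x)
    ; +-closed   = λ (r , y≈rx) (r′ , z≈r′x) → r + r′ , trans (+-cong y≈rx z≈r′x) (sym (distribʳ x r r′))
    ; neg-closed = λ (r , y≈rx) → - r , trans (-‿cong y≈rx) (-‿distribˡ-* r x)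
    ; *-closed   = λ s (r , y≈rx) → s * r , trans (*-congˡ y≈rx) (sym (*-assoc s r x))
    }

  -- Maximality of M applied to M + Rx.
  maximal-dichotomy : ∀ {M} → IsMaximal M → ∀ x → M x ⊎ ∃₂ λ a r → M a × 1# ≈ a + r * x
  maximal-dichotomy {M} (isM , _ , maximal) x
    with maximal (M +ᴵ Multiples x) (+ᴵ-isIdeal isM (Multiples-isIdeal x)) (⊆+ᴵˡ (Multiples-isIdeal x))
  ... | inj₁ (M+Rx⊆M , _) = inj₁ (M+Rx⊆M (⊆+ᴵʳ isM (1# , sym (*-identityˡ x))))
  ... | inj₂ (a , b , a∈M , (r , b≈rx) , 1≈a+b) = inj₂ (a , r , a∈M , trans 1≈a+b (+-congˡ b≈rx))

  local⇒1≉0 : IsLocal → ¬ (1# ≈ 0#)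
  local⇒1≉0 (_ , (isM , 1∉M , _) , _) = proper⇒1≉0 isM 1∉M

  field-1∈ : ∀ {I x} → IsField → IsIdeal I → I x → ¬ (x ≈ 0#) → I 1#
  field-1∈ {x = x} (_ , inverse) isI x∈I x≉0 with inverse x x≉0
  ... | y , xy≈1 = IsIdeal.∈-resp-≈ isI (trans (*-comm y x) xy≈1) (IsIdeal.*-closed isI y x∈I)

  module Classical (em : ∀ {p} → ExcludedMiddle p) where

    maximal⇒prime : ∀ {M} → IsMaximal M → IsPrime M
    maximal⇒prime {M} isMaximal@(isM , 1∉M , _) = isM , 1∉M , prime
      where
      module M = IsIdeal isM
      prime : ∀ x y → M (x * y) → M x ⊎ M y
      prime x y xy∈M with maximal-dichotomy isMaximal x
      ... | inj₁ x∈M = inj₁ x∈M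
      ... | inj₂ (a , r , a∈M , 1≈a+rx) =
        inj₂ (M.∈-resp-≈ ya+rxy≈y (M.+-closed (M.*-closed y a∈M) (M.*-closed r xy∈M)))
        where
        ya+rxy≈y : y * a + r * (x * y) ≈ y
        ya+rxy≈y = begin
          y * a + r * (x * y)  ≈⟨ +-congˡ (trans (sym (*-assoc r x y)) (*-comm (r * x) y)) ⟩
          y * a + y * (r * x)  ≈⟨ distribˡ y a (r * x) ⟨
          y * (a + r * x)      ≈⟨ *-congˡ 1≈a+rx ⟨
          y * 1#               ≈⟨ *-identityʳ y ⟩
          y                    ∎

    maximal-zero⇒field : ∀ {M} → IsMaximal M → ¬ IsNonzero M → IsField
    maximal-zero⇒field {M} isMaximal@(isM , 1∉M , _) M≡0 = proper⇒1≉0 isM 1∉M , inverse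
      where
      inverse : ∀ x → ¬ (x ≈ 0#) → ∃ λ y → x * y ≈ 1#
      inverse x x≉0 with maximal-dichotomy isMaximal x
      ... | inj₁ x∈M = ⊥-elim (M≡0 (x , x∈M , x≉0))
      ... | inj₂ (a , r , a∈M , 1≈a+rx) with em {P = a ≈ 0#}
      ...   | no a≉0 = ⊥-elim (M≡0 (a , a∈M , a≉0))
      ...   | yes a≈0 = r , (begin
        x * r       ≈⟨ *-comm x r ⟩
        r * x       ≈⟨ +-identityˡ (r * x) ⟨
        0# + r * x  ≈⟨ +-congʳ a≈0 ⟨
        a + r * x   ≈⟨ 1≈a+rx ⟨
        1#          ∎)

    field⇒Zero-prime : IsField → IsPrime Zero
    field⇒Zero-prime (1≉0 , inverse) = Zero-isIdeal , (λ (lift 1≈0) → 1≉0 1≈0) , prime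
      where
      prime : ∀ x y → Zero (x * y) → Zero x ⊎ Zero y
      prime x y (lift xy≈0) with em {P = x ≈ 0#}
      ... | yes x≈0 = inj₁ (lift x≈0)
      ... | no x≉0 with inverse x x≉0
      ...   | x⁻¹ , xx⁻¹≈1 = inj₂ (lift (begin
        y             ≈⟨ *-identityˡ y ⟨
        1# * y        ≈⟨ *-congʳ (trans (sym xx⁻¹≈1) (*-comm x x⁻¹)) ⟩
        (x⁻¹ * x) * y ≈⟨ *-assoc x⁻¹ x y ⟩
        x⁻¹ * (x * y) ≈⟨ *-congˡ xy≈0 ⟩
        x⁻¹ * 0#      ≈⟨ zeroʳ x⁻¹ ⟩
        0#            ∎))

    field-ideal : ∀ {I} → IsField → IsIdeal I → I ⊆ Zero ⊎ I 1#
    field-ideal {I} isField isI with em {P = I 1#}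
    ... | yes 1∈I = inj₂ 1∈I
    ... | no 1∉I = inj₁ I⊆0
      where
      I⊆0 : I ⊆ Zero
      I⊆0 {x} x∈I with em {P = x ≈ 0#}
      ... | yes x≈0 = lift x≈0
      ... | no x≉0 = ⊥-elim (1∉I (field-1∈ isField isI x∈I x≉0))

-- The prime ideal sum graph

-- The shape of EdgeOf with its endpoint conditions abstracted: EdgeOf C x y unfolds to
-- EdgeShape m (λ i → x ≈ᵛ v i) (λ i → y ≈ᵛ v i), and EdgeShape-map transports edges along vertex maps.
EdgeShape : (m : ℕ) → (X Y : Fin (suc (suc (suc m))) → Set a) → Set a
EdgeShape m X Y =
      (∃ λ (i : Fin (suc (suc m))) → (X (inject₁ i) × Y (suc i)) ⊎ (X (suc i) × Y (inject₁ i)))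
    ⊎ ((X (fromℕ (suc (suc m))) × Y zero) ⊎ (X zero × Y (fromℕ (suc (suc m)))))

EdgeShape-map : ∀ {m} {X Y X′ Y′ : Fin (suc (suc (suc m))) → Set a} →
  (∀ i → X i → X′ i) → (∀ i → Y i → Y′ i) → EdgeShape m X Y → EdgeShape m X′ Y′
EdgeShape-map f g (inj₁ (i , inj₁ (x , y))) = inj₁ (i , inj₁ (f _ x , g _ y))
EdgeShape-map f g (inj₁ (i , inj₂ (x , y))) = inj₁ (i , inj₂ (f _ x , g _ y))
EdgeShape-map f g (inj₂ (inj₁ (x , y)))     = inj₂ (inj₁ (f _ x , g _ y))
EdgeShape-map f g (inj₂ (inj₂ (x , y)))     = inj₂ (inj₂ (f _ x , g _ y))

injective⇒surjective : ∀ {m n} (f : Fin m → Fin (suc n)) → Injective _≡_ _≡_ f → n < m →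
  ∀ k → ∃ λ i → f i ≡ k
injective⇒surjective {m} {n} f f-inj n<m k with any? (λ i → f i ≟ k)
... | yes hit  = hit
... | no  miss =
  ⊥-elim (<⇒notInjective {f = g} n<m λ gᵢ≡gⱼ → f-inj (punchOut-injective (k≢f _) (k≢f _) gᵢ≡gⱼ))
  where
  k≢f : ∀ i → k ≢ f i
  k≢f i k≡fᵢ = miss (i , ≡.sym k≡fᵢ)
  g : Fin m → Fin n
  g i = punchOut (k≢f i)

data LastView : {n : ℕ} → Fin (suc n) → Set where
  last   : ∀ {n} → LastView (fromℕ n)
  inject : ∀ {n} (j : Fin n) → LastView (inject₁ j)

lastView : ∀ {n} (i : Fin (suc n)) → LastView i
lastView {zero}  zero    = last
lastView {suc n} zero    = inject zero
lastView {suc n} (suc i) with lastView i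
... | last     = last
... | inject j = inject (suc j)

module PIS (T : CommutativeRing c ℓ) where
  open CommutativeRing T using (1#)
  open IdealTheory T
  open Ideals T

  ≉-resp-≐ : ∀ {X Y U W : Subset} → X ≐ U → Y ≐ W → ¬ (U ≐ W) → ¬ (X ≐ Y)
  ≉-resp-≐ X≐U Y≐W U≉W X≐Y = U≉W (≐-trans (≐-sym X≐U) (≐-trans X≐Y Y≐W))

  Adj-sym : ∀ u w → Adj u w → Adj w u
  Adj-sym _ _ (u≉w , prime) = u≉w ∘ ≐-sym , IsPrime-resp-≐ (+ᴵ-comm , +ᴵ-comm) prime

  Adj-resp-≈ᵛ : ∀ u u′ w w′ → u ≈ᵛ u′ → w ≈ᵛ w′ → Adj u w → Adj u′ w′
  Adj-resp-≈ᵛ _ _ _ _ u≈u′ w≈w′ (u≉w , prime) =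
    ≉-resp-≐ (≐-sym u≈u′) (≐-sym w≈w′) u≉w , IsPrime-resp-≐ (+ᴵ-resp-≐ u≈u′ w≈w′) prime

  1∈+⇒¬Adj : ∀ u w → (proj₁ u +ᴵ proj₁ w) 1# → ¬ Adj u w
  1∈+⇒¬Adj _ _ 1∈u+w (_ , _ , 1∉u+w , _) = 1∉u+w 1∈u+w

  _∈ᶜ_ : Vertex → Cycle → Set (c ⊔ ℓ)
  u ∈ᶜ C = ∃ λ i → u ≈ᵛ Cycle.v C i

  EdgeOf⇒∈ᶜ : ∀ C x y → EdgeOf C x y → x ∈ᶜ C
  EdgeOf⇒∈ᶜ C _ _ (inj₁ (i , inj₁ (x≈ , _))) = inject₁ i , x≈
  EdgeOf⇒∈ᶜ C _ _ (inj₁ (i , inj₂ (x≈ , _))) = suc i , x≈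
  EdgeOf⇒∈ᶜ C _ _ (inj₂ (inj₁ (x≈ , _)))     = _ , x≈
  EdgeOf⇒∈ᶜ C _ _ (inj₂ (inj₂ (x≈ , _)))     = zero , x≈

  EdgeOf-sym : ∀ C x y → EdgeOf C x y → EdgeOf C y x
  EdgeOf-sym C _ _ (inj₁ (i , inj₁ (x≈ , y≈))) = inj₁ (i , inj₂ (y≈ , x≈))
  EdgeOf-sym C _ _ (inj₁ (i , inj₂ (x≈ , y≈))) = inj₁ (i , inj₁ (y≈ , x≈))
  EdgeOf-sym C _ _ (inj₂ (inj₁ (x≈ , y≈)))     = inj₂ (inj₂ (y≈ , x≈))
  EdgeOf-sym C _ _ (inj₂ (inj₂ (x≈ , y≈)))     = inj₂ (inj₁ (y≈ , x≈))

  EdgeOf⇒≉ : ∀ C x y → EdgeOf C x y → ¬ (x ≈ᵛ y)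
  EdgeOf⇒≉ C _ _ (inj₁ (i , inj₁ (x≈ , y≈))) = ≉-resp-≐ x≈ y≈ (proj₁ (Cycle.steps C i))
  EdgeOf⇒≉ C _ _ (inj₁ (i , inj₂ (x≈ , y≈))) = ≉-resp-≐ y≈ x≈ (proj₁ (Cycle.steps C i)) ∘ ≐-sym
  EdgeOf⇒≉ C _ _ (inj₂ (inj₁ (x≈ , y≈)))     = ≉-resp-≐ x≈ y≈ (proj₁ (Cycle.closing C))
  EdgeOf⇒≉ C _ _ (inj₂ (inj₂ (x≈ , y≈)))     = ≉-resp-≐ y≈ x≈ (proj₁ (Cycle.closing C)) ∘ ≐-sym

  edge-at : ∀ C i → ∃ λ y → EdgeOf C (Cycle.v C i) y
  edge-at C zero    = Cycle.v C (suc zero) , inj₁ (zero , inj₁ (≐-refl , ≐-refl))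
  edge-at C (suc i) = Cycle.v C (inject₁ i) , inj₁ (i , inj₂ (≐-refl , ≐-refl))

  ¬Unicyclic-of-∉ᶜ : ∀ C D i → ¬ (Cycle.v C i ∈ᶜ D) → ¬ Unicyclic
  ¬Unicyclic-of-∉ᶜ C D i vᵢ∉D (_ , _ , unique) with edge-at C i
  ... | y , edge = vᵢ∉D (EdgeOf⇒∈ᶜ D vᵢ y (proj₁ (unique D vᵢ y) (proj₂ (unique C vᵢ y) edge)))
    where
    vᵢ : Vertex
    vᵢ = Cycle.v C i

  IsSumOf⇒Adj : ∀ x y (p : Vertex) → IsPrime (proj₁ p) → IsSumOf (proj₁ p) (proj₁ x) (proj₁ y) →
    ¬ (x ≈ᵛ y) → Adj x y
  IsSumOf⇒Adj _ _ (_ , isP , _) prime sum x≉y = x≉y , IsPrime-resp-≐ (≐-sym (IsSumOf⇒+ᴵ≐ isP sum)) prime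

  -- As x, y ⊆ p, also y + p = p + x = p, so the prime p = x + y makes x, y, p pairwise adjacent.
  record SumTriangle : Set (Level.suc (c ⊔ ℓ)) where
    field
      x y p : Vertex
      prime : IsPrime (proj₁ p)
      sum   : IsSumOf (proj₁ p) (proj₁ x) (proj₁ y)
      x≉y   : ¬ (x ≈ᵛ y)
      y≉p   : ¬ (y ≈ᵛ p)
      p≉x   : ¬ (p ≈ᵛ x)

    vertex : Fin 3 → Vertex
    vertex zero             = x
    vertex (suc zero)       = y
    vertex (suc (suc zero)) = p

    private
      isX : IsIdeal (proj₁ x)
      isX = proj₁ (proj₂ x)
      isY : IsIdeal (proj₁ y)
      isY = proj₁ (proj₂ y)
      x⊆p : proj₁ x ⊆ proj₁ p
      x⊆p = proj₁ sum
      y⊆p : proj₁ y ⊆ proj₁ p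
      y⊆p = proj₁ (proj₂ sum)

    x~y : Adj x y
    x~y = IsSumOf⇒Adj x y p prime sum x≉y

    y~p : Adj y p
    y~p = IsSumOf⇒Adj y p p prime (IsSumOf-⊆ˡ isY y⊆p) y≉p

    p~x : Adj p x
    p~x = IsSumOf⇒Adj p x p prime (IsSumOf-⊆ʳ isX x⊆p) p≉x

    cycle : Cycle
    cycle = record { m = 0 ; v = vertex ; distinct = distinct ; steps = steps ; closing = p~x }
      where
      steps : ∀ (i : Fin 2) → Adj (vertex (inject₁ i)) (vertex (suc i))
      steps zero       = x~y
      steps (suc zero) = y~p
      distinct : ∀ i j → vertex i ≈ᵛ vertex j → i ≡ j
      distinct zero             zero             _ = ≡.refl
      distinct (suc zero)       (suc zero)       _ = ≡.refl
      distinct (suc (suc zero)) (suc (suc zero)) _ = ≡.refl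
      distinct zero             (suc zero)       e = ⊥-elim (x≉y e)
      distinct zero             (suc (suc zero)) e = ⊥-elim (p≉x (≐-sym e))
      distinct (suc zero)       zero             e = ⊥-elim (x≉y (≐-sym e))
      distinct (suc zero)       (suc (suc zero)) e = ⊥-elim (y≉p e)
      distinct (suc (suc zero)) zero             e = ⊥-elim (p≉x e)
      distinct (suc (suc zero)) (suc zero)       e = ⊥-elim (y≉p (≐-sym e))

    ∉ᶜcycle : ∀ {u} → ¬ (u ≈ᵛ x) → ¬ (u ≈ᵛ y) → ¬ (u ≈ᵛ p) → ¬ (u ∈ᶜ cycle)
    ∉ᶜcycle u≉x _   _   (zero           , u≈x) = u≉x u≈x
    ∉ᶜcycle _   u≉y _   (suc zero       , u≈y) = u≉y u≈y
    ∉ᶜcycle _   _   u≉p (suc (suc zero) , u≈p) = u≉p u≈p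

  cycle-neighbours : ∀ C i →
    ∃₂ λ j k → j ≢ k × Adj (Cycle.v C i) (Cycle.v C j) × Adj (Cycle.v C i) (Cycle.v C k)
  cycle-neighbours C zero =
    suc zero , fromℕ _ , (λ ()) , steps zero , Adj-sym (v (fromℕ _)) (v zero) closing
    where open Cycle C
  cycle-neighbours C (suc i) with lastView i
  ... | last     =
    inject₁ (fromℕ _) , zero , (λ ()) ,
    Adj-sym (v (inject₁ (fromℕ _))) (v (suc i)) (steps (fromℕ _)) , closing
    where open Cycle C
  ... | inject j =
    inject₁ (inject₁ j) , suc (suc j) , before≢after j ,
    Adj-sym (v (inject₁ (inject₁ j))) (v (suc i)) (steps (inject₁ j)) , steps (suc j)
    where
    open Cycle C
    before≢after : ∀ {n} (j : Fin n) → inject₁ (inject₁ j) ≢ suc (suc j)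
    before≢after zero    ()
    before≢after (suc j) eq = before≢after j (suc-injective eq)

  leaf∉cycle : ∀ C i h → (∀ w → Adj (Cycle.v C i) w → w ≈ᵛ h) → ⊥
  leaf∉cycle C i h leaf with cycle-neighbours C i
  ... | j , k , j≢k , i~j , i~k =
    j≢k (Cycle.distinct C j k (≐-trans (leaf (Cycle.v C j) i~j) (≐-sym (leaf (Cycle.v C k) i~k))))

  cycle-classes-injective : ∀ C {k} (rep : Fin k → Vertex) (cls : Fin (suc (suc (suc (Cycle.m C)))) → Fin k) →
                            (∀ i → Cycle.v C i ≈ᵛ rep (cls i)) → Injective _≡_ _≡_ cls
  cycle-classes-injective C rep cls v≈rep {i} {j} clsᵢ≡clsⱼ = Cycle.distinct C i j
    (≐-trans (subst (λ k → Cycle.v C i ≈ᵛ rep k) clsᵢ≡clsⱼ (v≈rep i)) (≐-sym (v≈rep j)))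

  triangle-EdgeOf : ∀ C → Cycle.m C ≡ 0 → ∀ x y → x ∈ᶜ C → y ∈ᶜ C → ¬ (x ≈ᵛ y) → EdgeOf C x y
  triangle-EdgeOf C ≡.refl _ _ (zero           , x≈) (suc zero       , y≈) _ = inj₁ (zero , inj₁ (x≈ , y≈))
  triangle-EdgeOf C ≡.refl _ _ (suc zero       , x≈) (zero           , y≈) _ = inj₁ (zero , inj₂ (x≈ , y≈))
  triangle-EdgeOf C ≡.refl _ _ (suc zero       , x≈) (suc (suc zero) , y≈) _ = inj₁ (suc zero , inj₁ (x≈ , y≈))
  triangle-EdgeOf C ≡.refl _ _ (suc (suc zero) , x≈) (suc zero       , y≈) _ = inj₁ (suc zero , inj₂ (x≈ , y≈))
  triangle-EdgeOf C ≡.refl _ _ (suc (suc zero) , x≈) (zero           , y≈) _ = inj₂ (inj₁ (x≈ , y≈))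
  triangle-EdgeOf C ≡.refl _ _ (zero           , x≈) (suc (suc zero) , y≈) _ = inj₂ (inj₂ (x≈ , y≈))
  triangle-EdgeOf C ≡.refl _ _ (zero           , x≈) (zero           , y≈) x≉y = ⊥-elim (x≉y (≐-trans x≈ (≐-sym y≈)))
  triangle-EdgeOf C ≡.refl _ _ (suc zero       , x≈) (suc zero       , y≈) x≉y = ⊥-elim (x≉y (≐-trans x≈ (≐-sym y≈)))
  triangle-EdgeOf C ≡.refl _ _ (suc (suc zero) , x≈) (suc (suc zero) , y≈) x≉y = ⊥-elim (x≉y (≐-trans x≈ (≐-sym y≈)))

  path : ∀ {n} (p : Fin (suc n) → Vertex) → (∀ i → Adj (p (inject₁ i)) (p (suc i))) →
    Path (p zero) (p (fromℕ n))
  path p steps = record { len = _ ; p = p ; start = ≐-refl ; end = ≐-refl ; steps = steps }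

  Path-resp : ∀ {u u′ w w′} → u ≈ᵛ u′ → w ≈ᵛ w′ → Path u w → Path u′ w′
  Path-resp u≈u′ w≈w′ π = record
    { len = len ; p = p ; start = ≐-trans start u≈u′ ; end = ≐-trans end w≈w′ ; steps = steps }
    where open Path π

  connected-via-hub : (∀ {p} → ExcludedMiddle p) → ∀ h → (∀ u → ¬ (u ≈ᵛ h) → Adj u h) → Connected
  connected-via-hub em h hub u w with em {P = u ≈ᵛ w} | em {P = u ≈ᵛ h} | em {P = w ≈ᵛ h}
  ... | yes u≈w | _       | _       = Path-resp ≐-refl u≈w (path (u ∷ []) λ ())
  ... | no u≉w  | yes u≈h | _       =
    Path-resp (≐-sym u≈h) ≐-refl
      (path (h ∷ w ∷ []) λ { zero → Adj-sym w h (hub w λ w≈h → u≉w (≐-trans u≈h (≐-sym w≈h))) })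
  ... | no _    | no u≉h  | yes w≈h =
    Path-resp ≐-refl (≐-sym w≈h) (path (u ∷ h ∷ []) λ { zero → hub u u≉h })
  ... | no _    | no u≉h  | no w≉h  =
    path (u ∷ h ∷ w ∷ []) λ { zero → hub u u≉h ; (suc zero) → Adj-sym w h (hub w w≉h) }

-- Invariance under ring isomorphisms

record PISEmbedding (T U : CommutativeRing c ℓ) : Set (Level.suc (c ⊔ ℓ)) where
  private
    module IT = IdealTheory T
    module IU = IdealTheory U
  field
    map      : IT.Vertex → IU.Vertex
    cong     : ∀ {u w} → u IT.≈ᵛ w → map u IU.≈ᵛ map w
    reflects : ∀ {u w} → map u IU.≈ᵛ map w → u IT.≈ᵛ w
    adj      : ∀ {u w} → IT.Adj u w → IU.Adj (map u) (map w)

  mapPath : ∀ {u w} → IT.Path u w → IU.Path (map u) (map w)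
  mapPath π = record
    { len = len ; p = map ∘ p ; start = cong start ; end = cong end ; steps = adj ∘ steps }
    where open IT.Path π

  mapCycle : IT.Cycle → IU.Cycle
  mapCycle C = record
    { m = m ; v = map ∘ v ; distinct = λ i j → distinct i j ∘ reflects
    ; steps = adj ∘ steps ; closing = adj closing
    }
    where open IT.Cycle C

-- F carries the unique cycle of T over; another cycle of U is compared with it after pulling it back by G.
Unicyclic-transport : {T U : CommutativeRing c ℓ} (F : PISEmbedding T U) (G : PISEmbedding U T) →
  (∀ u → IdealTheory._≈ᵛ_ U (PISEmbedding.map F (PISEmbedding.map G u)) u) →
  IdealTheory.Unicyclic T → IdealTheory.Unicyclic U
Unicyclic-transport {T = T} {U = U} F G FG≈id (connected , C , unique) =
  connectedᵁ , F.mapCycle C , uniqueᵁ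
  where
  module F = PISEmbedding F
  module G = PISEmbedding G
  open IdealTheory U
  module IT = IdealTheory T
  connectedᵁ : Connected
  connectedᵁ u w = PIS.Path-resp U (FG≈id u) (FG≈id w) (F.mapPath (connected (G.map u) (G.map w)))
  uniqueᵁ : ∀ D → SameCycle (F.mapCycle C) D
  uniqueᵁ D x y = to , from
    where
    same : IT.SameCycle C (G.mapCycle D)
    same = unique (G.mapCycle D)
    back : ∀ z i → G.map z IT.≈ᵛ G.map (Cycle.v D i) → z ≈ᵛ Cycle.v D i
    back z i = G.reflects {z} {Cycle.v D i}
    forth : ∀ z i → z ≈ᵛ Cycle.v D i → G.map z IT.≈ᵛ G.map (Cycle.v D i)
    forth z i = G.cong {z} {Cycle.v D i}
    into : ∀ z i → z ≈ᵛ F.map (IT.Cycle.v C i) → G.map z IT.≈ᵛ IT.Cycle.v C i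
    into z i z≈ = F.reflects {G.map z} (≐-trans (FG≈id z) z≈)
    outof : ∀ z i → G.map z IT.≈ᵛ IT.Cycle.v C i → z ≈ᵛ F.map (IT.Cycle.v C i)
    outof z i z≈ = ≐-trans (≐-sym (FG≈id z)) (F.cong {G.map z} z≈)
    to : EdgeOf (F.mapCycle C) x y → EdgeOf D x y
    to = EdgeShape-map (back x) (back y) ∘ proj₁ (same (G.map x) (G.map y)) ∘
         EdgeShape-map (into x) (into y)
    from : EdgeOf D x y → EdgeOf (F.mapCycle C) x y
    from = EdgeShape-map (outof x) (outof y) ∘ proj₂ (same (G.map x) (G.map y)) ∘
           EdgeShape-map (forth x) (forth y)

record RingIso (T U : CommutativeRing c ℓ) : Set (c ⊔ ℓ) where
  private
    module T = CommutativeRing T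
    module U = CommutativeRing U
  field
    to        : T.Carrier → U.Carrier
    from      : U.Carrier → T.Carrier
    to-cong   : ∀ {x y} → x T.≈ y → to x U.≈ to y
    from-cong : ∀ {x y} → x U.≈ y → from x T.≈ from y
    to-+      : ∀ x y → to (x T.+ y) U.≈ to x U.+ to y
    to-*      : ∀ x y → to (x T.* y) U.≈ to x U.* to y
    to-neg    : ∀ x → to (T.- x) U.≈ U.- to x
    to-0      : to T.0# U.≈ U.0#
    to-1      : to T.1# U.≈ U.1#
    to-from   : ∀ y → to (from y) U.≈ y
    from-to   : ∀ x → from (to x) T.≈ x

module _ {T U : CommutativeRing c ℓ} where
  private
    module T = CommutativeRing T
    module U = CommutativeRing U

  RingIso-sym : RingIso T U → RingIso U T
  RingIso-sym φ = record
    { to = from ; from = to ; to-cong = from-cong ; from-cong = to-cong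
    ; to-+ = from-homo₂ U.+-cong to-+ ; to-* = from-homo₂ U.*-cong to-*
    ; to-neg = λ y → T.trans (from-cong (U.-‿cong (U.sym (to-from y))))
                     (T.trans (from-cong (U.sym (to-neg (from y)))) (from-to _))
    ; to-0 = T.trans (from-cong (U.sym to-0)) (from-to _)
    ; to-1 = T.trans (from-cong (U.sym to-1)) (from-to _)
    ; to-from = from-to ; from-to = to-from
    }
    where
    open RingIso φ
    from-homo₂ : ∀ {_∙_ : Op₂ T.Carrier} {_∘_ : Op₂ U.Carrier} →
      (∀ {x x′ y y′} → x U.≈ x′ → y U.≈ y′ → (x ∘ y) U.≈ (x′ ∘ y′)) →
      (∀ x y → to (x ∙ y) U.≈ (to x ∘ to y)) → ∀ x y → from (x ∘ y) T.≈ (from x ∙ from y)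
    from-homo₂ ∘-cong to-homo x y =
      T.trans (from-cong (∘-cong (U.sym (to-from x)) (U.sym (to-from y))))
        (T.trans (from-cong (U.sym (to-homo (from x) (from y)))) (from-to _))

  ≅ʳ⇒RingIso : T ≅ʳ U → RingIso T U
  ≅ʳ⇒RingIso (f , isIso) = record
    { to = f ; from = from ; to-cong = ⟦⟧-cong
    ; from-cong = λ {x} {y} x≈y → injective (U.trans (to-from x) (U.trans x≈y (U.sym (to-from y))))
    ; to-+ = +-homo ; to-* = *-homo ; to-neg = -‿homo ; to-0 = 0#-homo ; to-1 = 1#-homo
    ; to-from = to-from ; from-to = λ x → injective (to-from (f x))
    }
    where
    open RingMorphisms (CommutativeRing.rawRing T) (CommutativeRing.rawRing U)
    open IsRingIsomorphism isIso
    from : U.Carrier → T.Carrier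
    from y = proj₁ (surjective y)
    to-from : ∀ y → f (from y) U.≈ y
    to-from y = proj₂ (surjective y) T.refl

≅ʳ-trans : {R S T : CommutativeRing c ℓ} → R ≅ʳ S → S ≅ʳ T → R ≅ʳ T
≅ʳ-trans {T = T} (f , f-iso) (g , g-iso) =
  g ∘ f , Composition.isRingIsomorphism (CommutativeRing.trans T) f-iso g-iso

×ʳ-comm : (A B : CommutativeRing c ℓ) → (A ×ʳ B) ≅ʳ (B ×ʳ A)
×ʳ-comm A B = swap , record
  { isRingMonomorphism = record
    { isRingHomomorphism = record
      { isSemiringHomomorphism = record
        { isNearSemiringHomomorphism = record
          { +-isMonoidHomomorphism = record
            { isMagmaHomomorphism = record
              { isRelHomomorphism = record { cong = swap }
              ; homo = λ _ _ → refl }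
            ; ε-homo = refl }
          ; *-homo = λ _ _ → refl }
        ; 1#-homo = refl }
      ; -‿homo = λ _ → refl }
    ; injective = swap }
  ; surjective = λ y → swap y , swap
  }
  where open CommutativeRing (B ×ʳ A) using (refl)

module Pullback {T U : CommutativeRing c ℓ} (φ : RingIso T U) where
  private
    module T = CommutativeRing T
    module U = CommutativeRing U
    module IT = IdealTheory T
    module IU = IdealTheory U
    module φ⁻¹ = RingIso (RingIso-sym φ)
  open RingIso φ

  pull : IU.Subset → IT.Subset
  pull I x = I (to x)

  pull-isIdeal : ∀ {I} → IU.IsIdeal I → IT.IsIdeal (pull I)
  pull-isIdeal isI = record
    { ∈-resp-≈   = λ x≈y → I.∈-resp-≈ (to-cong x≈y)
    ; 0∈         = I.∈-resp-≈ (U.sym to-0) I.0∈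
    ; +-closed   = λ x∈ y∈ → I.∈-resp-≈ (U.sym (to-+ _ _)) (I.+-closed x∈ y∈)
    ; neg-closed = λ x∈ → I.∈-resp-≈ (U.sym (to-neg _)) (I.neg-closed x∈)
    ; *-closed   = λ r x∈ → I.∈-resp-≈ (U.sym (to-* _ _)) (I.*-closed (to r) x∈)
    }
    where module I = IU.IsIdeal isI

  pull-isPrime : ∀ {P} → IU.IsPrime P → IT.IsPrime (pull P)
  pull-isPrime (isP , 1∉P , prime) =
    pull-isIdeal isP , (λ 1∈ → 1∉P (P.∈-resp-≈ to-1 1∈)) ,
    λ x y xy∈ → prime (to x) (to y) (P.∈-resp-≈ (to-* x y) xy∈)
    where module P = IU.IsIdeal isP

  pull-+ᴵ : ∀ {I J} → IU.IsIdeal I → IU.IsIdeal J → pull (I IU.+ᴵ J) ≐ (pull I IT.+ᴵ pull J)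
  pull-+ᴵ {I} {J} isI isJ = split , join
    where
    split : pull (I IU.+ᴵ J) ⊆ (pull I IT.+ᴵ pull J)
    split {x} (a , b , a∈I , b∈J , tx≈a+b) =
      from a , from b , IU.IsIdeal.∈-resp-≈ isI (U.sym (to-from a)) a∈I ,
      IU.IsIdeal.∈-resp-≈ isJ (U.sym (to-from b)) b∈J ,
      T.trans (T.sym (from-to x)) (T.trans (from-cong tx≈a+b) (φ⁻¹.to-+ a b))
    join : (pull I IT.+ᴵ pull J) ⊆ pull (I IU.+ᴵ J)
    join (a , b , a∈ , b∈ , x≈a+b) = to a , to b , a∈ , b∈ , U.trans (to-cong x≈a+b) (to-+ a b)

  pullᵛ : IU.Vertex → IT.Vertex
  pullᵛ (I , isI , (y , y∈I , y≉0) , 1∉I) =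
    pull I , pull-isIdeal isI ,
    (from y , IU.IsIdeal.∈-resp-≈ isI (U.sym (to-from y)) y∈I ,
      λ fy≈0 → y≉0 (U.trans (U.sym (to-from y)) (U.trans (to-cong fy≈0) to-0))) ,
    λ 1∈ → 1∉I (IU.IsIdeal.∈-resp-≈ isI to-1 1∈)

  pullᵛ-reflects : ∀ {u w} → pullᵛ u IT.≈ᵛ pullᵛ w → u IU.≈ᵛ w
  pullᵛ-reflects {_ , isI , _} {_ , isJ , _} (I⊆J , J⊆I) =
    (λ y∈I → J.∈-resp-≈ (to-from _) (I⊆J (I.∈-resp-≈ (U.sym (to-from _)) y∈I))) ,
    (λ y∈J → I.∈-resp-≈ (to-from _) (J⊆I (J.∈-resp-≈ (U.sym (to-from _)) y∈J)))
    where
    module I = IU.IsIdeal isI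
    module J = IU.IsIdeal isJ

  embedding : PISEmbedding U T
  embedding = record
    { map      = pullᵛ
    ; cong     = λ (I⊆J , J⊆I) → I⊆J , J⊆I
    ; reflects = λ {u} {w} → pullᵛ-reflects {u} {w}
    ; adj      = λ { {u} {w} (u≉w , prime) →
        u≉w ∘ pullᵛ-reflects {u} {w} ,
        Ideals.IsPrime-resp-≐ T (pull-+ᴵ (proj₁ (proj₂ u)) (proj₁ (proj₂ w))) (pull-isPrime prime) }
    }

Unicyclic-resp-RingIso : {T U : CommutativeRing c ℓ} → RingIso T U →
  IdealTheory.Unicyclic T → IdealTheory.Unicyclic U
Unicyclic-resp-RingIso {U = U} φ =
  Unicyclic-transport (Pullback.embedding (RingIso-sym φ)) (Pullback.embedding φ) λ where
    (_ , isI , _) → IdealTheory.IsIdeal.∈-resp-≈ isI (to-from _) ,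
                    IdealTheory.IsIdeal.∈-resp-≈ isI (CommutativeRing.sym U (to-from _))
  where open RingIso φ

-- Products of two rings

module Product (A B : CommutativeRing c ℓ) where
  private
    module A = CommutativeRing A
    module B = CommutativeRing B
    module P = CommutativeRing (A ×ʳ B)
    module IA = IdealTheory A
    module IB = IdealTheory B
    module ZA = Ideals A
    module ZB = Ideals B
  open IdealTheory (A ×ʳ B)

  _⊗_ : IA.Subset → IB.Subset → Subset
  (I ⊗ J) (a , b) = I a × J b

  ⊗-isIdeal : ∀ {I J} → IA.IsIdeal I → IB.IsIdeal J → IsIdeal (I ⊗ J)
  ⊗-isIdeal isI isJ = record
    { ∈-resp-≈   = λ (a≈ , b≈) (a∈ , b∈) → I.∈-resp-≈ a≈ a∈ , J.∈-resp-≈ b≈ b∈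
    ; 0∈         = I.0∈ , J.0∈
    ; +-closed   = λ (a∈ , b∈) (a′∈ , b′∈) → I.+-closed a∈ a′∈ , J.+-closed b∈ b′∈
    ; neg-closed = λ (a∈ , b∈) → I.neg-closed a∈ , J.neg-closed b∈
    ; *-closed   = λ (r , s) (a∈ , b∈) → I.*-closed r a∈ , J.*-closed s b∈
    }
    where
    module I = IA.IsIdeal isI
    module J = IB.IsIdeal isJ

  ⊗-isPrimeˡ : ∀ {Q J} → IA.IsPrime Q → IB.IsIdeal J → J B.1# → IsPrime (Q ⊗ J)
  ⊗-isPrimeˡ {Q} {J} (isQ , 1∉Q , prime) isJ 1∈J = ⊗-isIdeal isQ isJ , (λ (1∈Q , _) → 1∉Q 1∈Q) , primeQJ
    where
    primeQJ : ∀ x y → (Q ⊗ J) (x P.* y) → (Q ⊗ J) x ⊎ (Q ⊗ J) y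
    primeQJ (a , b) (a′ , b′) (aa′∈Q , _) with prime a a′ aa′∈Q
    ... | inj₁ a∈Q  = inj₁ (a∈Q , ZB.1∈⇒Whole⊆ isJ 1∈J _)
    ... | inj₂ a′∈Q = inj₂ (a′∈Q , ZB.1∈⇒Whole⊆ isJ 1∈J _)

  ⊗-isPrimeʳ : ∀ {I Q} → IA.IsIdeal I → I A.1# → IB.IsPrime Q → IsPrime (I ⊗ Q)
  ⊗-isPrimeʳ {I} {Q} isI 1∈I (isQ , 1∉Q , prime) = ⊗-isIdeal isI isQ , (λ (_ , 1∈Q) → 1∉Q 1∈Q) , primeIQ
    where
    primeIQ : ∀ x y → (I ⊗ Q) (x P.* y) → (I ⊗ Q) x ⊎ (I ⊗ Q) y
    primeIQ (a , b) (a′ , b′) (_ , bb′∈Q) with prime b b′ bb′∈Q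
    ... | inj₁ b∈Q  = inj₁ (ZA.1∈⇒Whole⊆ isI 1∈I _ , b∈Q)
    ... | inj₂ b′∈Q = inj₂ (ZA.1∈⇒Whole⊆ isI 1∈I _ , b′∈Q)

  ⊗-IsSumOf : ∀ {P₁ X₁ Y₁ P₂ X₂ Y₂} → Ideals.IsSumOf A P₁ X₁ Y₁ → Ideals.IsSumOf B P₂ X₂ Y₂ →
    Ideals.IsSumOf (A ×ʳ B) (P₁ ⊗ P₂) (X₁ ⊗ X₂) (Y₁ ⊗ Y₂)
  ⊗-IsSumOf {P₁} {X₁} {Y₁} {P₂} {X₂} {Y₂} (X₁⊆P₁ , Y₁⊆P₁ , P₁⊆X₁+Y₁) (X₂⊆P₂ , Y₂⊆P₂ , P₂⊆X₂+Y₂) =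
    (λ (a∈ , b∈) → X₁⊆P₁ a∈ , X₂⊆P₂ b∈) ,
    (λ (a∈ , b∈) → Y₁⊆P₁ a∈ , Y₂⊆P₂ b∈) ,
    λ (a∈ , b∈) → decompose (P₁⊆X₁+Y₁ a∈) (P₂⊆X₂+Y₂ b∈)
    where
    decompose : ∀ {a b} → (X₁ IA.+ᴵ Y₁) a → (X₂ IB.+ᴵ Y₂) b → ((X₁ ⊗ X₂) +ᴵ (Y₁ ⊗ Y₂)) (a , b)
    decompose (x₁ , y₁ , x₁∈ , y₁∈ , a≈) (x₂ , y₂ , x₂∈ , y₂∈ , b≈) =
      (x₁ , x₂) , (y₁ , y₂) , (x₁∈ , x₂∈) , (y₁∈ , y₂∈) , (a≈ , b≈)

  ⊗-vertex : ∀ {I J} → IA.IsIdeal I → IB.IsIdeal J → (z : P.Carrier) → (I ⊗ J) z → ¬ (z P.≈ P.0#) →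
    ¬ (I ⊗ J) P.1# → Vertex
  ⊗-vertex isI isJ z z∈ z≉0 1∉ = _ , ⊗-isIdeal isI isJ , (z , z∈ , z≉0) , 1∉

  module Nontrivial (A1≉0 : ¬ (A.1# A.≈ A.0#)) (B1≉0 : ¬ (B.1# B.≈ B.0#)) where

    A×0 : Vertex
    A×0 = ⊗-vertex ZA.Whole-isIdeal ZB.Zero-isIdeal (A.1# , B.0#) (_ , lift B.refl)
            (A1≉0 ∘ proj₁) (B1≉0 ∘ lower ∘ proj₂)

    0×B : Vertex
    0×B = ⊗-vertex ZA.Zero-isIdeal ZB.Whole-isIdeal (A.0# , B.1#) (lift A.refl , _)
            (B1≉0 ∘ proj₂) (A1≉0 ∘ lower ∘ proj₁)

  ⊗-≐⇒≐ʳ : ∀ {I I′ J J′} → IA.IsIdeal I → IA.IsIdeal I′ → (I ⊗ J) ≐ (I′ ⊗ J′) → J ≐ J′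
  ⊗-≐⇒≐ʳ isI isI′ (I⊗J⊆I′⊗J′ , I′⊗J′⊆I⊗J) =
    (λ b∈J → proj₂ (I⊗J⊆I′⊗J′ (IA.IsIdeal.0∈ isI , b∈J))) ,
    (λ b∈J′ → proj₂ (I′⊗J′⊆I⊗J (IA.IsIdeal.0∈ isI′ , b∈J′)))

  firstOf : Subset → IA.Subset
  firstOf I a = I (a , B.0#)

  secondOf : Subset → IB.Subset
  secondOf I b = I (A.0# , b)

  module _ {I} (isI : IsIdeal I) where
    private module I = IsIdeal isI

    firstOf-isIdeal : IA.IsIdeal (firstOf I)
    firstOf-isIdeal = record
      { ∈-resp-≈   = λ a≈ → I.∈-resp-≈ (a≈ , B.refl)
      ; 0∈         = I.0∈
      ; +-closed   = λ a∈ a′∈ → I.∈-resp-≈ (A.refl , B.+-identityˡ B.0#) (I.+-closed a∈ a′∈)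
      ; neg-closed = λ a∈ → I.∈-resp-≈ (A.refl , RingProperties.-0#≈0# B.ring) (I.neg-closed a∈)
      ; *-closed   = λ r a∈ → I.∈-resp-≈ (A.refl , B.zeroˡ B.0#) (I.*-closed (r , B.0#) a∈)
      }

    secondOf-isIdeal : IB.IsIdeal (secondOf I)
    secondOf-isIdeal = record
      { ∈-resp-≈   = λ b≈ → I.∈-resp-≈ (A.refl , b≈)
      ; 0∈         = I.0∈
      ; +-closed   = λ b∈ b′∈ → I.∈-resp-≈ (A.+-identityˡ A.0# , B.refl) (I.+-closed b∈ b′∈)
      ; neg-closed = λ b∈ → I.∈-resp-≈ (RingProperties.-0#≈0# A.ring , B.refl) (I.neg-closed b∈)
      ; *-closed   = λ r b∈ → I.∈-resp-≈ (A.zeroˡ A.0# , B.refl) (I.*-closed (A.0# , r) b∈)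
      }

    -- Multiplying by the idempotents (1,0) and (0,1) splits I.
    ≐firstOf⊗secondOf : I ≐ (firstOf I ⊗ secondOf I)
    ≐firstOf⊗secondOf = split , join
      where
      split : I ⊆ (firstOf I ⊗ secondOf I)
      split {a , b} ab∈I =
        I.∈-resp-≈ (A.*-identityˡ a , B.zeroˡ b) (I.*-closed (A.1# , B.0#) ab∈I) ,
        I.∈-resp-≈ (A.zeroˡ a , B.*-identityˡ b) (I.*-closed (A.0# , B.1#) ab∈I)
      join : (firstOf I ⊗ secondOf I) ⊆ I
      join {a , b} (a0∈I , 0b∈I) = I.∈-resp-≈ (A.+-identityʳ a , B.+-identityˡ b) (I.+-closed a0∈I 0b∈I)

    firstOf-≐Zero : firstOf I ⊆ ZA.Zero → firstOf I ≐ ZA.Zero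
    firstOf-≐Zero = ZA.⊆Zero⇒≐ firstOf-isIdeal

    firstOf-≐Whole : firstOf I A.1# → firstOf I ≐ ZA.Whole
    firstOf-≐Whole = ZA.1∈⇒≐Whole firstOf-isIdeal

    secondOf-≐Zero : secondOf I ⊆ ZB.Zero → secondOf I ≐ ZB.Zero
    secondOf-≐Zero = ZB.⊆Zero⇒≐ secondOf-isIdeal

    secondOf-≐Whole : secondOf I B.1# → secondOf I ≐ ZB.Whole
    secondOf-≐Whole = ZB.1∈⇒≐Whole secondOf-isIdeal

    coordinates-zero⇒¬nonzero : firstOf I ⊆ ZA.Zero → secondOf I ⊆ ZB.Zero → ¬ IsNonzero I
    coordinates-zero⇒¬nonzero I₁⊆0 I₂⊆0 (z , z∈I , z≉0) =
      let (z₁∈ , z₂∈) = proj₁ ≐firstOf⊗secondOf z∈I in z≉0 (lower (I₁⊆0 z₁∈) , lower (I₂⊆0 z₂∈))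

    coordinates-1⇒¬proper : firstOf I A.1# → secondOf I B.1# → ¬ IsProper I
    coordinates-1⇒¬proper 1∈I₁ 1∈I₂ 1∉I = 1∉I (proj₂ ≐firstOf⊗secondOf (1∈I₁ , 1∈I₂))

    ≐⊗ : ∀ {K₁ K₂} → firstOf I ≐ K₁ → secondOf I ≐ K₂ → I ≐ (K₁ ⊗ K₂)
    ≐⊗ (I₁⊆K₁ , K₁⊆I₁) (I₂⊆K₂ , K₂⊆I₂) =
      (λ ab∈I → let (a∈ , b∈) = proj₁ ≐firstOf⊗secondOf ab∈I in I₁⊆K₁ a∈ , I₂⊆K₂ b∈) ,
      (λ (a∈ , b∈) → proj₂ ≐firstOf⊗secondOf (K₁⊆I₁ a∈ , K₂⊆I₂ b∈))

-- Products whose graph is not unicyclic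

module _ (A B : CommutativeRing c ℓ) where
  private
    module A = CommutativeRing A
    module B = CommutativeRing B
    module IA = IdealTheory A
    module IB = IdealTheory B
    module ZA = Ideals A
    module ZB = Ideals B
  open IdealTheory (A ×ʳ B)
  open Ideals (A ×ʳ B) using (separate; separate′)
  open Product A B
  open PIS (A ×ʳ B)

  -- P × B lies on the triangle P×0, 0×B, P×B but not on A×0, 0×Q, A×Q.
  ¬Unicyclic-nonzero-primes : ∀ {P Q} → IA.IsPrime P → IA.IsNonzero P → IB.IsPrime Q → IB.IsNonzero Q →
    ¬ Unicyclic
  ¬Unicyclic-nonzero-primes P-prime@(isP , 1∉P , _) (p , p∈P , p≉0) Q-prime@(isQ , 1∉Q , _) (q , q∈Q , q≉0) =
    ¬Unicyclic-of-∉ᶜ T₁.cycle T₂.cycle (suc (suc zero)) (T₂.∉ᶜcycle {P×B}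
      (separate {x = A.0# , B.1#} (P.0∈ , _) (B1≉0 ∘ lower ∘ proj₂))
      (separate {x = A.0# , B.1#} (P.0∈ , _) (1∉Q ∘ proj₂))
      (separate {x = A.0# , B.1#} (P.0∈ , _) (1∉Q ∘ proj₂)))
    where
    module P = IA.IsIdeal isP
    A1≉0 : ¬ (A.1# A.≈ A.0#)
    A1≉0 = ZA.proper⇒1≉0 isP 1∉P
    B1≉0 : ¬ (B.1# B.≈ B.0#)
    B1≉0 = ZB.proper⇒1≉0 isQ 1∉Q
    open Nontrivial A1≉0 B1≉0
    P×0 P×B 0×Q A×Q : Vertex
    P×0 = ⊗-vertex isP ZB.Zero-isIdeal (p , B.0#) (p∈P , lift B.refl) (p≉0 ∘ proj₁) (1∉P ∘ proj₁)
    P×B = ⊗-vertex isP ZB.Whole-isIdeal (p , B.0#) (p∈P , _) (p≉0 ∘ proj₁) (1∉P ∘ proj₁)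
    0×Q = ⊗-vertex ZA.Zero-isIdeal isQ (A.0# , q) (lift A.refl , q∈Q) (q≉0 ∘ proj₂) (1∉Q ∘ proj₂)
    A×Q = ⊗-vertex ZA.Whole-isIdeal isQ (A.0# , q) (_ , q∈Q) (q≉0 ∘ proj₂) (1∉Q ∘ proj₂)
    t₁ : SumTriangle
    t₁ = record
      { x = P×0 ; y = 0×B ; p = P×B
      ; prime = ⊗-isPrimeˡ P-prime ZB.Whole-isIdeal _
      ; sum = ⊗-IsSumOf (ZA.IsSumOf-⊆ʳ ZA.Zero-isIdeal (ZA.Zero⊆ isP)) (ZB.IsSumOf-⊆ˡ ZB.Zero-isIdeal _)
      ; x≉y = separate {x = p , B.0#} (p∈P , lift B.refl) (p≉0 ∘ lower ∘ proj₁)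
      ; y≉p = separate′ {x = p , B.0#} (p≉0 ∘ lower ∘ proj₁) (p∈P , _)
      ; p≉x = separate {x = A.0# , B.1#} (P.0∈ , _) (B1≉0 ∘ lower ∘ proj₂)
      }
    module T₁ = SumTriangle t₁
    t₂ : SumTriangle
    t₂ = record
      { x = A×0 ; y = 0×Q ; p = A×Q
      ; prime = ⊗-isPrimeʳ ZA.Whole-isIdeal _ Q-prime
      ; sum = ⊗-IsSumOf (ZA.IsSumOf-⊆ʳ ZA.Zero-isIdeal _) (ZB.IsSumOf-⊆ˡ ZB.Zero-isIdeal (ZB.Zero⊆ isQ))
      ; x≉y = separate {x = A.1# , B.0#} (_ , lift B.refl) (A1≉0 ∘ lower ∘ proj₁)
      ; y≉p = separate′ {x = A.1# , B.0#} (A1≉0 ∘ lower ∘ proj₁) (_ , IB.IsIdeal.0∈ isQ)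
      ; p≉x = separate {x = A.0# , q} (_ , q∈Q) (q≉0 ∘ lower ∘ proj₂)
      }
    module T₂ = SumTriangle t₂

module _ (A B C : CommutativeRing c ℓ) where
  private
    module A = CommutativeRing A
    module B = CommutativeRing B
    module C = CommutativeRing C
    module IA = IdealTheory A
    module IB = IdealTheory B
    module ZA = Ideals A
    module ZB = Ideals B
    module ZC = Ideals C
    module ZBC = Ideals (B ×ʳ C)
    module BC = Product B C
  open IdealTheory (A ×ʳ (B ×ʳ C))
  open Ideals (A ×ʳ (B ×ʳ C)) using (separate; separate′)
  open Product A (B ×ʳ C)
  open PIS (A ×ʳ (B ×ʳ C))

  -- P × B × C lies on the triangle P×B×0, P×0×C, P×B×C but not on A×Q×0, 0×Q×C, A×Q×C.
  ¬Unicyclic-three-factors : ∀ {P Q} → IA.IsPrime P → IB.IsPrime Q → ¬ (C.1# C.≈ C.0#) → ¬ Unicyclic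
  ¬Unicyclic-three-factors P-prime@(isP , 1∉P , _) Q-prime@(isQ , 1∉Q , _) C1≉0 =
    ¬Unicyclic-of-∉ᶜ T₁.cycle T₂.cycle (suc (suc zero)) (T₂.∉ᶜcycle {P×B×C}
      (separate {x = 0,1,0} (P.0∈ , _) (1∉Q ∘ proj₁ ∘ proj₂))
      (separate {x = 0,1,0} (P.0∈ , _) (1∉Q ∘ proj₁ ∘ proj₂))
      (separate {x = 0,1,0} (P.0∈ , _) (1∉Q ∘ proj₁ ∘ proj₂)))
    where
    module P = IA.IsIdeal isP
    module Q = IB.IsIdeal isQ
    A1≉0 : ¬ (A.1# A.≈ A.0#)
    A1≉0 = ZA.proper⇒1≉0 isP 1∉P
    B1≉0 : ¬ (B.1# B.≈ B.0#)
    B1≉0 = ZB.proper⇒1≉0 isQ 1∉Q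
    0,1,0 0,0,1 1,0,0 : A.Carrier × B.Carrier × C.Carrier
    0,1,0 = A.0# , B.1# , C.0#
    0,0,1 = A.0# , B.0# , C.1#
    1,0,0 = A.1# , B.0# , C.0#
    P×B×0 P×0×C P×B×C A×Q×0 0×Q×C A×Q×C : Vertex
    P×B×0 = ⊗-vertex isP (BC.⊗-isIdeal ZB.Whole-isIdeal ZC.Zero-isIdeal) 0,1,0 (P.0∈ , _ , lift C.refl)
      (B1≉0 ∘ proj₁ ∘ proj₂) (1∉P ∘ proj₁)
    P×0×C = ⊗-vertex isP (BC.⊗-isIdeal ZB.Zero-isIdeal ZC.Whole-isIdeal) 0,0,1 (P.0∈ , lift B.refl , _)
      (C1≉0 ∘ proj₂ ∘ proj₂) (1∉P ∘ proj₁)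
    P×B×C = ⊗-vertex isP (BC.⊗-isIdeal ZB.Whole-isIdeal ZC.Whole-isIdeal) 0,1,0 (P.0∈ , _)
      (B1≉0 ∘ proj₁ ∘ proj₂) (1∉P ∘ proj₁)
    A×Q×0 = ⊗-vertex ZA.Whole-isIdeal (BC.⊗-isIdeal isQ ZC.Zero-isIdeal) 1,0,0 (_ , Q.0∈ , lift C.refl)
      (A1≉0 ∘ proj₁) (1∉Q ∘ proj₁ ∘ proj₂)
    0×Q×C = ⊗-vertex ZA.Zero-isIdeal (BC.⊗-isIdeal isQ ZC.Whole-isIdeal) 0,0,1 (lift A.refl , Q.0∈ , _)
      (C1≉0 ∘ proj₂ ∘ proj₂) (A1≉0 ∘ lower ∘ proj₁)
    A×Q×C = ⊗-vertex ZA.Whole-isIdeal (BC.⊗-isIdeal isQ ZC.Whole-isIdeal) 1,0,0 (_ , Q.0∈ , _)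
      (A1≉0 ∘ proj₁) (1∉Q ∘ proj₁ ∘ proj₂)
    t₁ : SumTriangle
    t₁ = record
      { x = P×B×0 ; y = P×0×C ; p = P×B×C
      ; prime = ⊗-isPrimeˡ P-prime (BC.⊗-isIdeal ZB.Whole-isIdeal ZC.Whole-isIdeal) _
      ; sum = ⊗-IsSumOf (ZA.IsSumOf-⊆ˡ isP λ a∈P → a∈P)
          (BC.⊗-IsSumOf (ZB.IsSumOf-⊆ʳ ZB.Zero-isIdeal _) (ZC.IsSumOf-⊆ˡ ZC.Zero-isIdeal _))
      ; x≉y = separate {x = 0,1,0} (P.0∈ , _ , lift C.refl) (B1≉0 ∘ lower ∘ proj₁ ∘ proj₂)
      ; y≉p = separate′ {x = 0,1,0} (B1≉0 ∘ lower ∘ proj₁ ∘ proj₂) (P.0∈ , _)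
      ; p≉x = separate {x = 0,0,1} (P.0∈ , _) (C1≉0 ∘ lower ∘ proj₂ ∘ proj₂)
      }
    module T₁ = SumTriangle t₁
    t₂ : SumTriangle
    t₂ = record
      { x = A×Q×0 ; y = 0×Q×C ; p = A×Q×C
      ; prime = ⊗-isPrimeʳ ZA.Whole-isIdeal _ (BC.⊗-isPrimeˡ Q-prime ZC.Whole-isIdeal _)
      ; sum = ⊗-IsSumOf (ZA.IsSumOf-⊆ʳ ZA.Zero-isIdeal _)
          (ZBC.IsSumOf-⊆ˡ (BC.⊗-isIdeal isQ ZC.Zero-isIdeal) λ (b∈Q , _) → b∈Q , _)
      ; x≉y = separate {x = 1,0,0} (_ , Q.0∈ , lift C.refl) (A1≉0 ∘ lower ∘ proj₁)
      ; y≉p = separate′ {x = 1,0,0} (A1≉0 ∘ lower ∘ proj₁) (_ , Q.0∈ , _)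
      ; p≉x = separate {x = 0,0,1} (_ , Q.0∈ , _) (C1≉0 ∘ lower ∘ proj₂ ∘ proj₂)
      }
    module T₂ = SumTriangle t₂

module FieldProduct (em : ∀ {p} → ExcludedMiddle p) (A B : CommutativeRing c ℓ) where
  private
    module A = CommutativeRing A
    module B = CommutativeRing B
    module IA = IdealTheory A
    module IB = IdealTheory B
    module ZA = Ideals A
    module ZB = Ideals B
    module CA = ZA.Classical em
    module CB = ZB.Classical em
  open IdealTheory (A ×ʳ B)
  open Ideals (A ×ʳ B) using (separate; separate′)
  open Product A B
  open PIS (A ×ʳ B)

  -- Over two fields the only vertices are A×0 and 0×B, too few for a cycle.
  ¬Unicyclic-field×field : IA.IsField → IB.IsField → ¬ Unicyclic
  ¬Unicyclic-field×field A-field@(A1≉0 , _) B-field@(B1≉0 , _) (_ , C , _) =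
    <⇒notInjective (s≤s (s≤s (s≤s z≤n)))
      (cycle-classes-injective C rep (proj₁ ∘ classify ∘ v) (proj₂ ∘ classify ∘ v))
    where
    open Cycle C using (v)
    open Nontrivial A1≉0 B1≉0
    rep : Fin 2 → Vertex
    rep zero       = A×0
    rep (suc zero) = 0×B
    classify : ∀ u → ∃ λ k → u ≈ᵛ rep k
    classify (I , isI , I≢0 , 1∉I)
      with CA.field-ideal A-field (firstOf-isIdeal isI) | CB.field-ideal B-field (secondOf-isIdeal isI)
    ... | inj₁ I₁⊆0 | inj₁ I₂⊆0 = ⊥-elim (coordinates-zero⇒¬nonzero isI I₁⊆0 I₂⊆0 I≢0)
    ... | inj₂ 1∈I₁ | inj₂ 1∈I₂ = ⊥-elim (coordinates-1⇒¬proper isI 1∈I₁ 1∈I₂ 1∉I)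
    ... | inj₂ 1∈I₁ | inj₁ I₂⊆0 = zero , ≐⊗ isI (firstOf-≐Whole isI 1∈I₁) (secondOf-≐Zero isI I₂⊆0)
    ... | inj₁ I₁⊆0 | inj₂ 1∈I₂ = suc zero , ≐⊗ isI (firstOf-≐Zero isI I₁⊆0) (secondOf-≐Whole isI 1∈I₂)

  module _ (A-field : IA.IsField) {M : IB.Subset} (M-max : IB.IsMaximal M) (M≢0 : IB.IsNonzero M) where
    private
      isM : IB.IsIdeal M
      isM = proj₁ M-max
      1∉M : IB.IsProper M
      1∉M = proj₁ (proj₂ M-max)
      m : B.Carrier
      m = proj₁ M≢0
      m∈M : M m
      m∈M = proj₁ (proj₂ M≢0)
      m≉0 : ¬ (m B.≈ B.0#)
      m≉0 = proj₂ (proj₂ M≢0)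
      module M = IB.IsIdeal isM
      A1≉0 : ¬ (A.1# A.≈ A.0#)
      A1≉0 = proj₁ A-field
      B1≉0 : ¬ (B.1# B.≈ B.0#)
      B1≉0 = ZB.proper⇒1≉0 isM 1∉M

    Mᵛ : IB.Vertex
    Mᵛ = M , isM , M≢0 , 1∉M

    private
      open Nontrivial A1≉0 B1≉0
      0×M A×M : Vertex
      0×M = ⊗-vertex ZA.Zero-isIdeal isM (A.0# , m) (lift A.refl , m∈M) (m≉0 ∘ proj₂) (A1≉0 ∘ lower ∘ proj₁)
      A×M = ⊗-vertex ZA.Whole-isIdeal isM (A.0# , m) (_ , m∈M) (m≉0 ∘ proj₂) (1∉M ∘ proj₂)

      t₁ : SumTriangle
      t₁ = record
        { x = A×0 ; y = 0×M ; p = A×M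
        ; prime = ⊗-isPrimeʳ ZA.Whole-isIdeal _ (CB.maximal⇒prime M-max)
        ; sum = ⊗-IsSumOf (ZA.IsSumOf-⊆ʳ ZA.Zero-isIdeal _) (ZB.IsSumOf-⊆ˡ ZB.Zero-isIdeal (ZB.Zero⊆ isM))
        ; x≉y = separate {x = A.1# , B.0#} (_ , lift B.refl) (A1≉0 ∘ lower ∘ proj₁)
        ; y≉p = separate′ {x = A.1# , B.0#} (A1≉0 ∘ lower ∘ proj₁) (_ , M.0∈)
        ; p≉x = separate {x = A.0# , m} (_ , m∈M) (m≉0 ∘ lower ∘ proj₂)
        }
      module T₁ = SumTriangle t₁

    -- A vertex J ⊂ M besides M gives the triangle A×J, 0×M, A×M; A×J is not on T₁.
    ¬Unicyclic-of-⊂ : ∀ J → ¬ (J IB.≈ᵛ Mᵛ) → proj₁ J ⊆ M → ¬ Unicyclic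
    ¬Unicyclic-of-⊂ (J , isJ , (j , j∈J , j≉0) , 1∉J) J≉M J⊆M =
      ¬Unicyclic-of-∉ᶜ T₂.cycle T₁.cycle zero (T₁.∉ᶜcycle {A×J}
        (separate {x = A.0# , j} (_ , j∈J) (j≉0 ∘ lower ∘ proj₂))
        (separate {x = A.1# , B.0#} (_ , J.0∈) (A1≉0 ∘ lower ∘ proj₁))
        A×J≉A×M)
      where
      module J = IB.IsIdeal isJ
      A×J : Vertex
      A×J = ⊗-vertex ZA.Whole-isIdeal isJ (A.0# , j) (_ , j∈J) (j≉0 ∘ proj₂) (1∉J ∘ proj₂)
      A×J≉A×M : ¬ (A×J ≈ᵛ A×M)
      A×J≉A×M = J≉M ∘ ⊗-≐⇒≐ʳ ZA.Whole-isIdeal ZA.Whole-isIdeal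
      t₂ : SumTriangle
      t₂ = record
        { x = A×J ; y = 0×M ; p = A×M
        ; prime = T₁.prime
        ; sum = ⊗-IsSumOf (ZA.IsSumOf-⊆ʳ ZA.Zero-isIdeal _) (ZB.IsSumOf-⊆ˡ isJ J⊆M)
        ; x≉y = separate {x = A.1# , B.0#} (_ , J.0∈) (A1≉0 ∘ lower ∘ proj₁)
        ; y≉p = T₁.y≉p
        ; p≉x = A×J≉A×M ∘ ≐-sym
        }
      module T₂ = SumTriangle t₂

    -- A vertex J with J + M = B gives the triangle 0×J, 0×M, 0×B; 0×B is not on T₁.
    ¬Unicyclic-of-coprime : ∀ J → ¬ (J IB.≈ᵛ Mᵛ) → (proj₁ J IB.+ᴵ M) B.1# → ¬ Unicyclic
    ¬Unicyclic-of-coprime (J , isJ , (j , j∈J , j≉0) , 1∉J) J≉M 1∈J+M =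
      ¬Unicyclic-of-∉ᶜ T₃.cycle T₁.cycle (suc (suc zero)) (T₁.∉ᶜcycle {0×B}
        (separate {x = A.0# , B.1#} (lift A.refl , _) (B1≉0 ∘ lower ∘ proj₂))
        (separate {x = A.0# , B.1#} (lift A.refl , _) (1∉M ∘ proj₂))
        (separate {x = A.0# , B.1#} (lift A.refl , _) (1∉M ∘ proj₂)))
      where
      0×J : Vertex
      0×J = ⊗-vertex ZA.Zero-isIdeal isJ (A.0# , j) (lift A.refl , j∈J) (j≉0 ∘ proj₂) (A1≉0 ∘ lower ∘ proj₁)
      t₃ : SumTriangle
      t₃ = record
        { x = 0×J ; y = 0×M ; p = 0×B
        ; prime = ⊗-isPrimeˡ (CA.field⇒Zero-prime A-field) ZB.Whole-isIdeal _
        ; sum = ⊗-IsSumOf (ZA.IsSumOf-⊆ˡ ZA.Zero-isIdeal λ a∈0 → a∈0) (ZB.IsSumOf-Whole isJ isM 1∈J+M)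
        ; x≉y = J≉M ∘ ⊗-≐⇒≐ʳ ZA.Zero-isIdeal ZA.Zero-isIdeal
        ; y≉p = separate′ {x = A.0# , B.1#} (1∉M ∘ proj₂) (lift A.refl , _)
        ; p≉x = separate {x = A.0# , B.1#} (lift A.refl , _) (1∉J ∘ proj₂)
        }
      module T₃ = SumTriangle t₃

  Unicyclic-field×local⇒special : IA.IsField → IB.IsLocal → Unicyclic → IB.OnlyIdealIsMaximal
  Unicyclic-field×local⇒special A-field B-local@(M , M-max@(isM , _ , maximal) , _) unicyclic
    with em {P = IB.IsNonzero M}
  ... | no M≡0 = ⊥-elim (¬Unicyclic-field×field A-field (CB.maximal-zero⇒field M-max M≡0) unicyclic)
  ... | yes M≢0 with em {P = ∃ λ J → ¬ (J IB.≈ᵛ Mᵛ A-field M-max M≢0)}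
  ...   | no onlyM =
    B-local , Mᵛ A-field M-max M≢0 , M-max , λ J → em⇒dne em (λ J≉M → onlyM (J , J≉M))
  ...   | yes (J , J≉M)
    with maximal (proj₁ J IB.+ᴵ M) (ZB.+ᴵ-isIdeal (proj₁ (proj₂ J)) isM) (ZB.⊆+ᴵʳ (proj₁ (proj₂ J)))
  ...     | inj₁ (J+M⊆M , _) =
    ⊥-elim (¬Unicyclic-of-⊂ A-field M-max M≢0 J J≉M (J+M⊆M ∘ ZB.⊆+ᴵˡ isM) unicyclic)
  ...     | inj₂ 1∈J+M = ⊥-elim (¬Unicyclic-of-coprime A-field M-max M≢0 J J≉M 1∈J+M unicyclic)

-- A field times a local ring with a single nonzero proper ideal

module FieldSpecial (em : ∀ {p} → ExcludedMiddle p) (F S : CommutativeRing c ℓ)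
  (F-field : IdealTheory.IsField F) (S-special : IdealTheory.OnlyIdealIsMaximal S) where
  private
    module F = CommutativeRing F
    module S = CommutativeRing S
    module IF = IdealTheory F
    module IS = IdealTheory S
    module ZF = Ideals F
    module ZS = Ideals S
    module CF = ZF.Classical em
    module CS = ZS.Classical em
    module P = CommutativeRing (F ×ʳ S)
  open IdealTheory (F ×ʳ S)
  open Ideals (F ×ʳ S) using (separate; separate′)
  open Product F S
  open PIS (F ×ʳ S)

  private
    Mᵛ : IS.Vertex
    Mᵛ = proj₁ (proj₂ S-special)
    M : IS.Subset
    M = proj₁ Mᵛ
    M-max : IS.IsMaximal M
    M-max = proj₁ (proj₂ (proj₂ S-special))
    every≈M : ∀ I → I IS.≈ᵛ Mᵛ
    every≈M = proj₂ (proj₂ (proj₂ S-special))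
    isM : IS.IsIdeal M
    isM = proj₁ (proj₂ Mᵛ)
    1∉M : IS.IsProper M
    1∉M = proj₂ (proj₂ (proj₂ Mᵛ))
    m : S.Carrier
    m = proj₁ (proj₁ (proj₂ (proj₂ Mᵛ)))
    m∈M : M m
    m∈M = proj₁ (proj₂ (proj₁ (proj₂ (proj₂ Mᵛ))))
    m≉0 : ¬ (m S.≈ S.0#)
    m≉0 = proj₂ (proj₂ (proj₁ (proj₂ (proj₂ Mᵛ))))
    module M = IS.IsIdeal isM
    F1≉0 : ¬ (F.1# F.≈ F.0#)
    F1≉0 = proj₁ F-field
    S1≉0 : ¬ (S.1# S.≈ S.0#)
    S1≉0 = ZS.proper⇒1≉0 isM 1∉M

  S-ideal : ∀ {I} → IS.IsIdeal I → I ⊆ ZS.Zero ⊎ I ≐ M ⊎ I S.1#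
  S-ideal {I} isI with em {P = I S.1#} | em {P = IS.IsNonzero I}
  ... | yes 1∈I | _      = inj₂ (inj₂ 1∈I)
  ... | no 1∉I  | yes I≢0 = inj₂ (inj₁ (every≈M (I , isI , I≢0 , 1∉I)))
  ... | no _    | no I≡0  = inj₁ I⊆0
    where
    I⊆0 : I ⊆ ZS.Zero
    I⊆0 {x} x∈I with em {P = x S.≈ S.0#}
    ... | yes x≈0 = lift x≈0
    ... | no x≉0 = ⊥-elim (I≡0 (x , x∈I , x≉0))

  open Nontrivial F1≉0 S1≉0 renaming (A×0 to F×0; 0×B to 0×S)

  0×M F×M : Vertex
  0×M = ⊗-vertex ZF.Zero-isIdeal isM (F.0# , m) (lift F.refl , m∈M) (m≉0 ∘ proj₂) (F1≉0 ∘ lower ∘ proj₁)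
  F×M = ⊗-vertex ZF.Whole-isIdeal isM (F.0# , m) (_ , m∈M) (m≉0 ∘ proj₂) (1∉M ∘ proj₂)

  core : Fin 3 → Vertex
  core zero             = 0×M
  core (suc zero)       = F×0
  core (suc (suc zero)) = F×M

  classify : ∀ u → u ≈ᵛ 0×S ⊎ ∃ λ k → u ≈ᵛ core k
  classify (I , isI , I≢0 , 1∉I)
    with CF.field-ideal F-field (firstOf-isIdeal isI) | S-ideal (secondOf-isIdeal isI)
  ... | inj₁ I₁⊆0 | inj₁ I₂⊆0        = ⊥-elim (coordinates-zero⇒¬nonzero isI I₁⊆0 I₂⊆0 I≢0)
  ... | inj₂ 1∈I₁ | inj₂ (inj₂ 1∈I₂) = ⊥-elim (coordinates-1⇒¬proper isI 1∈I₁ 1∈I₂ 1∉I)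
  ... | inj₁ I₁⊆0 | inj₂ (inj₁ I₂≐M) = inj₂ (zero , ≐⊗ isI (firstOf-≐Zero isI I₁⊆0) I₂≐M)
  ... | inj₁ I₁⊆0 | inj₂ (inj₂ 1∈I₂) = inj₁ (≐⊗ isI (firstOf-≐Zero isI I₁⊆0) (secondOf-≐Whole isI 1∈I₂))
  ... | inj₂ 1∈I₁ | inj₁ I₂⊆0        = inj₂ (suc zero , ≐⊗ isI (firstOf-≐Whole isI 1∈I₁) (secondOf-≐Zero isI I₂⊆0))
  ... | inj₂ 1∈I₁ | inj₂ (inj₁ I₂≐M) = inj₂ (suc (suc zero) , ≐⊗ isI (firstOf-≐Whole isI 1∈I₁) I₂≐M)

  coreClass : ∀ u → ¬ (u ≈ᵛ 0×S) → ∃ λ k → u ≈ᵛ core k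
  coreClass u u≉0×S with classify u
  ... | inj₁ u≈0×S = ⊥-elim (u≉0×S u≈0×S)
  ... | inj₂ class = class

  t₀ : SumTriangle
  t₀ = record
    { x = F×0 ; y = 0×M ; p = F×M
    ; prime = ⊗-isPrimeʳ ZF.Whole-isIdeal _ (CS.maximal⇒prime M-max)
    ; sum = ⊗-IsSumOf (ZF.IsSumOf-⊆ʳ ZF.Zero-isIdeal _) (ZS.IsSumOf-⊆ˡ ZS.Zero-isIdeal (ZS.Zero⊆ isM))
    ; x≉y = separate {x = F.1# , S.0#} (_ , lift S.refl) (F1≉0 ∘ lower ∘ proj₁)
    ; y≉p = separate′ {x = F.1# , S.0#} (F1≉0 ∘ lower ∘ proj₁) (_ , M.0∈)
    ; p≉x = separate {x = F.0# , m} (_ , m∈M) (m≉0 ∘ lower ∘ proj₂)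
    }
  module T₀ = SumTriangle t₀

  0×S~0×M : Adj 0×S 0×M
  0×S~0×M = IsSumOf⇒Adj 0×S 0×M 0×S (⊗-isPrimeˡ (CF.field⇒Zero-prime F-field) ZS.Whole-isIdeal _)
    (⊗-IsSumOf (ZF.IsSumOf-⊆ˡ ZF.Zero-isIdeal λ a∈0 → a∈0) (ZS.IsSumOf-⊆ʳ isM _))
    (separate {x = F.0# , S.1#} (lift F.refl , _) (1∉M ∘ proj₂))

  hub : ∀ u → ¬ (u ≈ᵛ 0×M) → Adj u 0×M
  hub u u≉0×M with classify u
  ... | inj₁ u≈0×S                 = Adj-resp-≈ᵛ 0×S u 0×M 0×M (≐-sym u≈0×S) ≐-refl 0×S~0×M
  ... | inj₂ (zero , u≈0×M)        = ⊥-elim (u≉0×M u≈0×M)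
  ... | inj₂ (suc zero , u≈F×0)    = Adj-resp-≈ᵛ F×0 u 0×M 0×M (≐-sym u≈F×0) ≐-refl T₀.x~y
  ... | inj₂ (suc (suc zero) , u≈F×M) =
    Adj-resp-≈ᵛ F×M u 0×M 0×M (≐-sym u≈F×M) ≐-refl (Adj-sym 0×M F×M T₀.y~p)

  1∈+ : ∀ u (w : Vertex) → u ≈ᵛ 0×S → proj₁ w (F.1# , S.0#) → (proj₁ u +ᴵ proj₁ w) P.1#
  1∈+ u w u≈0×S 10∈w = (F.0# , S.1#) , (F.1# , S.0#) , proj₂ u≈0×S (lift F.refl , _) , 10∈w ,
    (F.sym (F.+-identityˡ F.1#) , S.sym (S.+-identityʳ S.1#))

  -- 0 × S is a leaf: a neighbour w other than 0 × M contains (1,0), making 0 × S + w everything.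
  leaf : ∀ u w → u ≈ᵛ 0×S → Adj u w → w ≈ᵛ 0×M
  leaf u w u≈0×S u~w with classify w
  ... | inj₁ w≈0×S                    = ⊥-elim (proj₁ u~w (≐-trans u≈0×S (≐-sym w≈0×S)))
  ... | inj₂ (zero , w≈0×M)           = w≈0×M
  ... | inj₂ (suc zero , w≈F×0)       =
    ⊥-elim (1∈+⇒¬Adj u w (1∈+ u w u≈0×S (proj₂ w≈F×0 (_ , lift S.refl))) u~w)
  ... | inj₂ (suc (suc zero) , w≈F×M) =
    ⊥-elim (1∈+⇒¬Adj u w (1∈+ u w u≈0×S (proj₂ w≈F×M (_ , M.0∈))) u~w)

  -- Every cycle avoids the leaf 0 × S, so its vertices have distinct classes among the three
  -- core classes: it is a triangle through all of them.
  EdgeOf⇔ : ∀ D x y → EdgeOf D x y ⇔ (¬ (x ≈ᵛ 0×S) × ¬ (y ≈ᵛ 0×S) × ¬ (x ≈ᵛ y))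
  EdgeOf⇔ D x y = mk⇔
    (λ e → ∈ᶜ⇒≉0×S x (EdgeOf⇒∈ᶜ D x y e) , ∈ᶜ⇒≉0×S y (EdgeOf⇒∈ᶜ D y x (EdgeOf-sym D x y e)) ,
           EdgeOf⇒≉ D x y e)
    (λ (x≉0×S , y≉0×S , x≉y) →
       triangle-EdgeOf D m≡0 x y (≉0×S⇒∈ᶜ x x≉0×S) (≉0×S⇒∈ᶜ y y≉0×S) x≉y)
    where
    open Cycle D using (v)
    vᵢ≉0×S : ∀ i → ¬ (v i ≈ᵛ 0×S)
    vᵢ≉0×S i vᵢ≈0×S = leaf∉cycle D i 0×M (λ w → leaf (v i) w vᵢ≈0×S)
    class : Fin _ → Fin 3
    class i = proj₁ (coreClass (v i) (vᵢ≉0×S i))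
    vᵢ≈core : ∀ i → v i ≈ᵛ core (class i)
    vᵢ≈core i = proj₂ (coreClass (v i) (vᵢ≉0×S i))
    class-injective : Injective _≡_ _≡_ class
    class-injective = cycle-classes-injective D core class vᵢ≈core
    m≡0 : Cycle.m D ≡ 0
    m≡0 = n≤0⇒n≡0 (≤-pred (≤-pred (≤-pred (injective⇒≤ class-injective))))
    ∈ᶜ⇒≉0×S : ∀ z → z ∈ᶜ D → ¬ (z ≈ᵛ 0×S)
    ∈ᶜ⇒≉0×S z (i , z≈vᵢ) z≈0×S = vᵢ≉0×S i (≐-trans (≐-sym z≈vᵢ) z≈0×S)
    ≉0×S⇒∈ᶜ : ∀ z → ¬ (z ≈ᵛ 0×S) → z ∈ᶜ D
    ≉0×S⇒∈ᶜ z z≉0×S with coreClass z z≉0×S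
    ... | k , z≈core with injective⇒surjective class class-injective (s≤s (s≤s (s≤s z≤n))) k
    ...   | i , classᵢ≡k =
      i , ≐-trans z≈core (≐-sym (subst (λ k → v i ≈ᵛ core k) classᵢ≡k (vᵢ≈core i)))

  unicyclic : Unicyclic
  unicyclic = connected-via-hub em 0×M hub , T₀.cycle , λ D x y →
    let T₀⇔D = ⇔.trans (EdgeOf⇔ T₀.cycle x y) (⇔.sym (EdgeOf⇔ D x y))
    in Equivalence.to T₀⇔D , Equivalence.from T₀⇔D

open IdealTheory using (Unicyclic; IsLocal; IsField; OnlyIdealIsMaximal; IsNonzero)
open Ideals.Classical using (maximal⇒prime; maximal-zero⇒field)

∏ʳ-nontrivial : ∀ {n} (Rs : Fin (suc n) → CommutativeRing c ℓ) → (∀ i → IsLocal (Rs i)) →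
  ¬ (CommutativeRing._≈_ (∏ʳ Rs) (CommutativeRing.1# (∏ʳ Rs)) (CommutativeRing.0# (∏ʳ Rs)))
∏ʳ-nontrivial {n = zero}  Rs local           = Ideals.local⇒1≉0 (Rs zero) (local zero)
∏ʳ-nontrivial {n = suc n} Rs local (1≈0 , _) = Ideals.local⇒1≉0 (Rs zero) (local zero) 1≈0

FieldTimesSpecial : CommutativeRing c ℓ → Set (Level.suc (c ⊔ ℓ))
FieldTimesSpecial {c} {ℓ} R =
  ∃₂ λ (F S : CommutativeRing c ℓ) → IsField F × OnlyIdealIsMaximal S × R ≅ʳ (F ×ʳ S)

module _ (em : ∀ {p} → ExcludedMiddle p) where

  FieldTimesSpecial-of-Unicyclic-× : ∀ (A B : CommutativeRing c ℓ) → IsLocal A → IsLocal B →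
    ∀ R → R ≅ʳ (A ×ʳ B) → Unicyclic (A ×ʳ B) → FieldTimesSpecial R
  FieldTimesSpecial-of-Unicyclic-× A B A-local@(M , M-max , _) B-local@(N , N-max , _) R R≅A×B unicyclic
    with em {P = IsNonzero A M} | em {P = IsNonzero B N}
  ... | no M≡0 | _ =
    let A-field = maximal-zero⇒field A em M-max M≡0
    in A , B , A-field , FieldProduct.Unicyclic-field×local⇒special em A B A-field B-local unicyclic , R≅A×B
  ... | yes _ | no N≡0 =
    let B-field = maximal-zero⇒field B em N-max N≡0
        A×B≅B×A = ≅ʳ⇒RingIso {T = A ×ʳ B} {U = B ×ʳ A} (×ʳ-comm A B)
    in B , A , B-field ,
       FieldProduct.Unicyclic-field×local⇒special em B A B-field A-local (Unicyclic-resp-RingIso A×B≅B×A unicyclic) ,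
       ≅ʳ-trans {R = R} {S = A ×ʳ B} {T = B ×ʳ A} R≅A×B (×ʳ-comm A B)
  ... | yes M≢0 | yes N≢0 = ⊥-elim
    (¬Unicyclic-nonzero-primes A B (maximal⇒prime A em M-max) M≢0 (maximal⇒prime B em N-max) N≢0 unicyclic)

  FieldTimesSpecial-of-Unicyclic-∏ʳ : ∀ m (Rs : Fin (suc (suc m)) → CommutativeRing c ℓ) →
    (∀ i → IsLocal (Rs i)) → ∀ R → R ≅ʳ ∏ʳ Rs → Unicyclic (∏ʳ Rs) → FieldTimesSpecial R
  FieldTimesSpecial-of-Unicyclic-∏ʳ zero Rs local =
    FieldTimesSpecial-of-Unicyclic-× (Rs zero) (Rs (suc zero)) (local zero) (local (suc zero))
  FieldTimesSpecial-of-Unicyclic-∏ʳ (suc m) Rs local _ _ unicyclic = ⊥-elim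
    (¬Unicyclic-three-factors (Rs zero) (Rs (suc zero)) (∏ʳ (λ i → Rs (suc (suc i))))
      (maximal⇒prime (Rs zero) em (proj₁ (proj₂ (local zero))))
      (maximal⇒prime (Rs (suc zero)) em (proj₁ (proj₂ (local (suc zero)))))
      (∏ʳ-nontrivial (λ i → Rs (suc (suc i))) (λ i → local (suc (suc i))))
      unicyclic)

mainTheorem5 : ∀ {c ℓ} → (∀ {p} → ExcludedMiddle p) →
    (m : ℕ) (Rs : Fin (suc (suc m)) → CommutativeRing c ℓ) →
    (∀ i → IsLocal (Rs i)) →
    (R : CommutativeRing c ℓ) → R ≅ʳ ∏ʳ Rs →
    Unicyclic R ⇔
      (∃₂ λ (F S : CommutativeRing c ℓ) →
         IsField F × OnlyIdealIsMaximal S × R ≅ʳ (F ×ʳ S))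
mainTheorem5 em m Rs local R R≅∏ = mk⇔
  (λ unicyclic → FieldTimesSpecial-of-Unicyclic-∏ʳ em m Rs local R R≅∏
                   (Unicyclic-resp-RingIso (≅ʳ⇒RingIso {T = R} {U = ∏ʳ Rs} R≅∏) unicyclic))
  (λ (F , S , F-field , S-special , R≅F×S) →
     Unicyclic-resp-RingIso (RingIso-sym (≅ʳ⇒RingIso {T = R} {U = F ×ʳ S} R≅F×S))
       (FieldSpecial.unicyclic em F S F-field S-special))
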